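{- Let $G$ be an $r$-graph on vertex set $[n]$ with average degree $d>0$, let $\tau,\zeta>0$, let $P_r=E(G)$ and let $P_{r-1},\dots,P_1$ be the final multisets constructed by the container algorithm (described in the context) using the strong threshold functions, in either build mode or prune mode. Then $$\sum_{u\in U}d_s(u)\le\bigl(\mu(U)+4^{1-s}\delta(G,\tau)\bigr)\tau^{r-s}nd$$ for all $U\subset[n]$ and all $1\le s\le r$.
   Context: An $r$-graph ($r\ge2$) is an $r$-uniform hypergraph; $d(\sigma)$ is the number of edges containing $\sigma$, $d(v)=d(\{v\})$, $d$ the average degree, $\mu(U)=\frac1{nd}\sum_{u\in U}d(u)$, and $d^{(j)}(\sigma)=\max\{d(\sigma'):\sigma\subset\sigma'\subset[n],|\sigma'|=j\}$, $d^{(j)}(v)=d^{(j)}(\{v\})$. Define $\delta_j$ by $\delta_j\tau^{j-1}nd=\sum_vd^{(j)}(v)$ ($2\le j\le r$) and $\delta(G,\tau)=2^{\binom r2-1}\sum_{j=2}^r2^{ -\binom{j-1}2}\delta_j$. Strong thresholds: for $1\le s\le r-1$, $\theta_s(\{u\})=\tau^{r-s}d(u)$, and for $2\le|\sigma|\le s$, $\theta_s(\sigma)=2^{\binom r2}\tau^{r-s}\sum_{\ell=0}^{r-s}2^{ -\binom{s+\ell}2}\tau^{ -\ell}d^{(|\sigma|+\ell)}(\sigma)$. Container algorithm (parameters $\tau,\zeta$, thresholds $\theta_s$ fixed in advance): $B=\{v:d(v)<\zeta d\}$; $P_r=E(G)$, and initially $P_1,\dots,P_{r-1}$ empty multisets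 and $\Gamma_1,\dots,\Gamma_{r-1}$ empty; $d_s(\sigma)$ is the number of members of $P_s$ (with multiplicity) containing $\sigma$. Prune mode: input $I$, initially $T=\emptyset$, output $T$; build mode: input $T$, initially $C=[n]$, output $C$. For $v=1,\dots,n$: for $s=1,\dots,r-1$ let $F_{v,s}$ be the multiset of $s$-sets $f\subset\{v+1,\dots,n\}$ with $\{v\}\cup f\in P_{s+1}$ (multiplicity inherited) containing no member of $\Gamma_s$. If $v\notin B$ and either $|F_{v,s}|\ge\zeta\tau^{r-s-1}d(v)$ for some $s$ or $\{v\}\in\Gamma_1$: in prune mode add $v$ to $T$ if $v\in I$; in build mode remove $v$ from $C$ if $v\notin T$; and if $v\in T$, for $s=1,\dots,r-1$ in turn add $F_{v,s}$ to $P_s$ and put into $\Gamma_s$ every $\sigma\subset\{v+1,\dots,n\}$, $1\le|\sigma|\le s$, with $d_s(\sigma)\ge\theta_s(\sigma)$. -}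

module Defs where

open import Data.Bool using (Bool; true; false; not; _∧_; _∨_; if_then_else_)
open import Data.Nat as ℕ using (ℕ; zero; suc; _∸_; _≡ᵇ_)
open import Data.Nat.Combinatorics using (_C_)
open import Data.Fin using (Fin; toℕ)
open import Data.Fin.Subset using (Subset; inside; outside; ⁅_⁆; ∣_∣; _∪_; ⊥; ⊤)
  renaming (_-_ to _minus_)
open import Data.Fin.Subset.Properties using (_⊆?_; _∈?_)
open import Data.List using (List; []; _∷_; [_]; map; _++_; filterᵇ; length; foldr; foldl; upTo; allFin)
open import Data.Bool.ListAction using (any; all)
open import Data.List.Relation.Unary.All using (All)
open import Data.List.Relation.Unary.Unique.Propositional using (Unique)
open import Data.Vec using (Vec; []; _∷_)
open import Data.Vec.Properties using (≡-dec)
import Data.Bool.Properties as BoolP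
open import Data.Integer using (+_)
open import Data.Rational as ℚ using (ℚ; 0ℚ; 1ℚ; _÷_; _≤ᵇ_)
open import Data.Rational.Properties using () renaming (_≟_ to _≟ℚ_)
open import Relation.Nullary using (yes; no)
open import Relation.Nullary.Decidable using (isYes)
open import Relation.Binary.PropositionalEquality using (_≡_)

toℚ : ℕ → ℚ
toℚ k = (+ k) ℚ./ 1

-- total division on ℚ: p ÷' 0 = 0 (only ever used with nonzero divisors
-- under the hypotheses of the lemma)
_÷'_ : ℚ → ℚ → ℚ
p ÷' q with q ≟ℚ 0ℚ
... | yes _ = 0ℚ
... | no q≢0 = _÷_ p q {{ℚ.≢-nonZero q≢0}}

_^ℚ_ : ℚ → ℕ → ℚ
p ^ℚ zero = 1ℚ
p ^ℚ suc k = p ℚ.* (p ^ℚ k)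

sumℚ : List ℚ → ℚ
sumℚ = foldr ℚ._+_ 0ℚ

sumℕ : List ℕ → ℕ
sumℕ = foldr ℕ._+_ 0

maxℕ : List ℕ → ℕ
maxℕ = foldr ℕ._⊔_ 0

-- the integers a, a+1, ..., b (empty if b < a)
range : ℕ → ℕ → List ℕ
range a b = map (a ℕ.+_) (upTo (suc b ∸ a))

allSubsets : ∀ n → List (Subset n)
allSubsets zero = [ [] ]
allSubsets (suc n) = map (outside ∷_) (allSubsets n) ++ map (inside ∷_) (allSubsets n)

_⊆ᵇ_ : ∀ {n} → Subset n → Subset n → Bool
σ ⊆ᵇ e = isYes (σ ⊆? e)

_∈ᵇ_ : ∀ {n} → Fin n → Subset n → Bool
v ∈ᵇ e = isYes (v ∈? e)

_≡ˢ_ : ∀ {n} → Subset n → Subset n → Bool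
σ ≡ˢ γ = isYes (≡-dec BoolP._≟_ σ γ)

-- vertices are Fin n, the vertex  i : Fin n  standing for  toℕ i + 1 ∈ [n];
-- above v σ  :  σ ⊆ {v+1,...,n}
above : ∀ {n} → Fin n → Subset n → Bool
above {n} v σ = all (λ x → not (x ∈ᵇ σ) ∨ (toℕ v ℕ.<ᵇ toℕ x)) (allFin n)

record Hypergraph (r n : ℕ) : Set where
  field
    edges   : List (Subset n)
    uniform : All (λ e → ∣ e ∣ ≡ r) edges
    simple  : Unique edges

open Hypergraph public

module _ {r n : ℕ} (G : Hypergraph r n) where

  dList : List (Subset n) → Subset n → ℕ
  dList P σ = length (filterᵇ (λ e → σ ⊆ᵇ e) P)

  deg : Subset n → ℕ
  deg σ = dList (edges G) σ

  degV : Fin n → ℕ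
  degV v = deg ⁅ v ⁆

  avgDeg : ℚ
  avgDeg = toℚ (sumℕ (map degV (allFin n))) ÷' toℚ n

  nd : ℚ
  nd = toℚ n ℚ.* avgDeg

  μ : Subset n → ℚ
  μ U = toℚ (sumℕ (map degV (filterᵇ (λ u → u ∈ᵇ U) (allFin n)))) ÷' nd

  degMax : ℕ → Subset n → ℕ
  degMax j σ = maxℕ (map deg (filterᵇ (λ σ' → (σ ⊆ᵇ σ') ∧ (∣ σ' ∣ ≡ᵇ j)) (allSubsets n)))

  module _ (τ : ℚ) where

    δj : ℕ → ℚ
    δj j = toℚ (sumℕ (map (λ v → degMax j ⁅ v ⁆) (allFin n))) ÷' ((τ ^ℚ (j ∸ 1)) ℚ.* nd)

    δ : ℚ
    δ = (toℚ 2 ^ℚ ((r C 2) ∸ 1)) ℚ.*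
        sumℚ (map (λ j → (1ℚ ÷' (toℚ 2 ^ℚ ((j ∸ 1) C 2))) ℚ.* δj j) (range 2 r))

    -- strong thresholds θ_s(σ) (used for 1 ≤ s ≤ r-1, 1 ≤ |σ| ≤ s)
    θ : ℕ → Subset n → ℚ
    θ s σ =
      if ∣ σ ∣ ≡ᵇ 1
      then (τ ^ℚ (r ∸ s)) ℚ.* toℚ (deg σ)
      else (toℚ 2 ^ℚ (r C 2)) ℚ.* (τ ^ℚ (r ∸ s)) ℚ.*
           sumℚ (map (λ ℓ → (1ℚ ÷' (toℚ 2 ^ℚ ((s ℕ.+ ℓ) C 2))) ℚ.* (1ℚ ÷' (τ ^ℚ ℓ))
                             ℚ.* toℚ (degMax (∣ σ ∣ ℕ.+ ℓ) σ))
                     (range 0 (r ∸ s)))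

-- prune mode with input I, or build mode with input T
data Mode (n : ℕ) : Set where
  prune : Subset n → Mode n
  build : Subset n → Mode n

record State (n : ℕ) : Set where
  field
    P : ℕ → List (Subset n)   -- P_1, ..., P_{r-1}  (multisets)
    Γ : ℕ → List (Subset n)
    T : Subset n
    C : Subset n

open State public

module Container {r n : ℕ} (G : Hypergraph r n) (τ ζ : ℚ) (mode : Mode n) where

  inRange : ℕ → Bool
  inRange s = (1 ℕ.≤ᵇ s) ∧ (s ℕ.≤ᵇ (r ∸ 1))

  Pfull : State n → ℕ → List (Subset n)
  Pfull st k = if k ≡ᵇ r then edges G else P st k

  F : State n → Fin n → ℕ → List (Subset n)
  F st v s =
    map (λ e → e minus v)
      (filterᵇ (λ e → (v ∈ᵇ e) ∧ above v (e minus v)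
                       ∧ not (any (λ γ → γ ⊆ᵇ (e minus v)) (Γ st s)))
               (Pfull st (suc s)))

  notInB : Fin n → Bool
  notInB v = (ζ ℚ.* avgDeg G) ≤ᵇ toℚ (degV G v)

  cond : State n → Fin n → Bool
  cond st v =
    notInB v ∧
    (any (λ s → (ζ ℚ.* (τ ^ℚ (r ∸ s ∸ 1)) ℚ.* toℚ (degV G v)) ≤ᵇ toℚ (length (F st v s)))
         (range 1 (r ∸ 1))
     ∨ any (λ γ → γ ≡ˢ ⁅ v ⁆) (Γ st 1))

  modeAction : State n → Fin n → State n
  modeAction st v = act mode
    where
      act : Mode n → State n
      act (prune I) = if v ∈ᵇ I then record st { T = T st ∪ ⁅ v ⁆ } else st
      act (build _) = if v ∈ᵇ T st then st else record st { C = C st minus v }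

  update : State n → Fin n → State n
  update st v = record st { P = newP ; Γ = newΓ }
    where
      newP : ℕ → List (Subset n)
      newP s = if inRange s then P st s ++ F st v s else P st s
      newΓ : ℕ → List (Subset n)
      newΓ s =
        if inRange s
        then Γ st s ++
             filterᵇ (λ σ → above v σ ∧ (1 ℕ.≤ᵇ ∣ σ ∣) ∧ (∣ σ ∣ ℕ.≤ᵇ s)
                             ∧ (θ G τ s σ ≤ᵇ toℚ (dList G (newP s) σ)))
                     (allSubsets n)
        else Γ st s

  step : State n → Fin n → State n
  step st v =
    if cond st v
    then (let st₁ = modeAction st v in
          if v ∈ᵇ T st₁ then update st₁ v else st₁)
    else st

  initial : State n
  initial = record
    { P = λ _ → []
    ; Γ = λ _ → []
    ; T = initT mode
    ; C = ⊤
    }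
    where
      initT : Mode n → Subset n
      initT (prune _) = ⊥
      initT (build T₀) = T₀

  final : State n
  final = foldl step initial (allFin n)

  dFinal : ℕ → Subset n → ℕ
  dFinal s σ = dList G (Pfull final s) σ

  sumDeg : ℕ → Subset n → ℕ
  sumDeg s U = sumℕ (map (λ u → dFinal s ⁅ u ⁆) (filterᵇ (λ u → u ∈ᵇ U) (allFin n)))

-- Write d_t for the multiplicities of the final P_t, so that d_r = d. While vertex v is processed,
-- F_{v,t} adds to d_t(σ) only if σ lies above v and contains no member of Γ_t; then σ ∉ Γ_t, so
-- d_t(σ) ≤ θ_t(σ) at that moment, and the increase is at most d_{t+1}(σ ∪ {v}). Hence, whatever the
-- mode and ζ,  d_t(σ) ≤ θ_t(σ) + max_{v ∉ σ} d_{t+1}(σ ∪ {v}).  Unfolding this from t = r downwards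
-- and using d^{(j)}(σ ∪ {v}) ≤ d^{(j)}(σ) gives, for 2 ≤ |σ| ≤ t,
--   d_t(σ) ≤ 2^{C(r,2)} τ^{r-t} Σ_{ℓ ≤ r-t} (ℓ+1) 2^{-C(t+ℓ,2)} τ^{-ℓ} d^{(|σ|+ℓ)}(σ),
-- and for a vertex u,  d_s(u) ≤ τ^{r-s} d(u) + max_v (that bound for {u, v} and t = s+1).  Summing
-- over u ∈ U, the first terms give μ(U) τ^{r-s} nd, and the second ones at most 4^{1-s} δ(G,τ) τ^{r-s} nd,
-- since Σ_{u ∈ [n]} d^{(2+ℓ)}(u) = δ_{2+ℓ} τ^{1+ℓ} nd and
--   (ℓ+1) 2^{C(r,2) - C(s+1+ℓ,2)} ≤ 4^{1-s} 2^{C(r,2) - 1 - C(ℓ+1,2)}.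

module Submission where

open import Defs hiding (T; C)

open import Algebra.Bundles using (CommutativeMonoid)
import Algebra.Properties.CommutativeSemigroup as CommSemigroupProperties
open import Data.Bool using (Bool; true; false; T; not; _∧_; _∨_; if_then_else_)
open import Data.Bool.ListAction using (any)
open import Data.Bool.Properties using (T-∧)
open import Data.Empty using (⊥-elim)
open import Data.Fin using (Fin; toℕ) renaming (zero to fzero; suc to fsuc)
open import Data.Fin.Subset using (Subset; inside; outside; ⁅_⁆; ∣_∣; _∪_; _-_; _─_; _∈_; _∉_; _⊆_)
import Data.Fin.Subset.Properties as Subsetₚ
import Data.Integer as ℤ
import Data.Integer.Properties as ℤ
open import Data.List using (List; []; _∷_; _++_; map; filterᵇ; length; foldl; applyUpTo; tabulate; allFin)
import Data.List.Properties as List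
open import Data.List.Membership.Propositional using (lose) renaming (_∈_ to _∈ₗ_)
open import Data.List.Membership.Propositional.Properties using (∈-map⁺; ∈-++⁺ˡ; ∈-++⁺ʳ; ∈-allFin; ∈-filter⁺)
import Data.List.Relation.Unary.All as All
open import Data.List.Relation.Unary.All.Properties using (all⁺; all⁻)
open import Data.List.Relation.Unary.Any using (here; there)
open import Data.List.Relation.Unary.Any.Properties using (any⁺)
open import Data.Nat as ℕ using (ℕ; zero; suc; _≤_; _<_; _∸_; z≤n; s≤s)
open import Data.Nat.Combinatorics using (_C_; nC1≡n; nCk+nC[k+1]≡[n+1]C[k+1])
open import Data.Nat.Coprimality using (1-coprimeTo) renaming (sym to coprime-sym)
import Data.Nat.Properties as ℕₚ
import Data.Nat.Tactic.RingSolver as ℕ-Ring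
open import Data.Product using (∃; _×_; _,_; proj₁; proj₂)
open import Data.Rational as ℚ using (ℚ; 0ℚ; 1ℚ; mkℚ; _+_; _*_; 1/_)
open import Data.Rational.Properties as ℚ
  using (≤-refl; ≤-trans; ≤-reflexive; <⇒≤; +-mono-≤; *-identityˡ; *-identityʳ; *-zeroʳ)
open import Data.Rational.Solver using (module +-*-Solver)
open +-*-Solver using (solve; _:=_; _:+_; _:*_; con)
open import Data.Sum using (_⊎_; inj₁; inj₂; [_,_]′)
open import Data.Unit using (⊤)
open import Data.Vec using ([]; _∷_)
import Data.Vec as Vec
open import Function using (_∘_)
open import Function.Bundles using (Equivalence)
open import Relation.Binary.PropositionalEquality
open import Relation.Nullary using (yes; no; ¬_)
open import Relation.Nullary.Decidable using (T?; fromWitness; toWitness)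
open import Relation.Nullary.Negation using (contradiction)

module +-Properties = CommSemigroupProperties (CommutativeMonoid.commutativeSemigroup ℚ.+-0-commutativeMonoid)
module *-Properties = CommSemigroupProperties (CommutativeMonoid.commutativeSemigroup ℚ.*-1-commutativeMonoid)

toℚ≡mkℚ : ∀ k → toℚ k ≡ mkℚ (ℤ.+ k) 0 (coprime-sym (1-coprimeTo k))
toℚ≡mkℚ k = ℚ.normalize-coprime (coprime-sym (1-coprimeTo k))

toℚ-+ : ∀ m n → toℚ (m ℕ.+ n) ≡ toℚ m + toℚ n
toℚ-+ m n rewrite toℚ≡mkℚ m | toℚ≡mkℚ n | ℤ.*-identityʳ (ℤ.+ m) | ℤ.*-identityʳ (ℤ.+ n) = refl

toℚ-* : ∀ m n → toℚ (m ℕ.* n) ≡ toℚ m * toℚ n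
toℚ-* m n rewrite toℚ≡mkℚ m | toℚ≡mkℚ n | sym (ℤ.pos-* m n) = refl

toℚ-mono-≤ : ∀ {m n} → m ≤ n → toℚ m ℚ.≤ toℚ n
toℚ-mono-≤ {m} {n} m≤n rewrite toℚ≡mkℚ m | toℚ≡mkℚ n =
  ℚ.*≤* (subst₂ ℤ._≤_ (sym (ℤ.*-identityʳ (ℤ.+ m))) (sym (ℤ.*-identityʳ (ℤ.+ n))) (ℤ.+≤+ m≤n))

toℚ-nonNeg : ∀ n → 0ℚ ℚ.≤ toℚ n
toℚ-nonNeg n = toℚ-mono-≤ {0} {n} z≤n

toℚ-pos : ∀ {n} → 0 < n → 0ℚ ℚ.< toℚ n
toℚ-pos {suc n} _ = ℚ.<-≤-trans (ℚ.positive⁻¹ 1ℚ) (toℚ-mono-≤ {1} {suc n} (s≤s z≤n))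

toℚ-^ : ∀ m k → toℚ m ^ℚ k ≡ toℚ (m ℕ.^ k)
toℚ-^ m zero = refl
toℚ-^ m (suc k) = trans (cong (toℚ m *_) (toℚ-^ m k)) (sym (toℚ-* m (m ℕ.^ k)))

*-nonNeg : ∀ {p q} → 0ℚ ℚ.≤ p → 0ℚ ℚ.≤ q → 0ℚ ℚ.≤ p * q
*-nonNeg {p} {q} 0≤p 0≤q =
  ℚ.nonNegative⁻¹ _ {{ℚ.nonNeg*nonNeg⇒nonNeg p {{ℚ.nonNegative 0≤p}} q {{ℚ.nonNegative 0≤q}}}}

*-pos : ∀ {p q} → 0ℚ ℚ.< p → 0ℚ ℚ.< q → 0ℚ ℚ.< p * q
*-pos {p} {q} 0<p 0<q = ℚ.positive⁻¹ _ {{ℚ.pos*pos⇒pos p {{ℚ.positive 0<p}} q {{ℚ.positive 0<q}}}}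

+-nonNeg : ∀ {p q} → 0ℚ ℚ.≤ p → 0ℚ ℚ.≤ q → 0ℚ ℚ.≤ p + q
+-nonNeg = +-mono-≤

*-monoˡ-≤-0≤ : ∀ {c p q} → 0ℚ ℚ.≤ c → p ℚ.≤ q → c * p ℚ.≤ c * q
*-monoˡ-≤-0≤ {c} 0≤c = ℚ.*-monoˡ-≤-nonNeg c {{ℚ.nonNegative 0≤c}}

*-monoʳ-≤-0≤ : ∀ {c p q} → 0ℚ ℚ.≤ c → p ℚ.≤ q → p * c ℚ.≤ q * c
*-monoʳ-≤-0≤ {c} 0≤c = ℚ.*-monoʳ-≤-nonNeg c {{ℚ.nonNegative 0≤c}}

^ℚ-nonNeg : ∀ {p} k → 0ℚ ℚ.≤ p → 0ℚ ℚ.≤ p ^ℚ k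
^ℚ-nonNeg zero 0≤p = ℚ.nonNegative⁻¹ 1ℚ
^ℚ-nonNeg (suc k) 0≤p = *-nonNeg 0≤p (^ℚ-nonNeg k 0≤p)

^ℚ-pos : ∀ {p} k → 0ℚ ℚ.< p → 0ℚ ℚ.< p ^ℚ k
^ℚ-pos zero 0<p = ℚ.positive⁻¹ 1ℚ
^ℚ-pos (suc k) 0<p = *-pos 0<p (^ℚ-pos k 0<p)

-- Defs writes 1ℚ ÷' q, which is 0 at q = 0.
recip : ℚ → ℚ
recip q = 1ℚ ÷' q

÷'≡*recip : ∀ p q → p ÷' q ≡ p * recip q
÷'≡*recip p q with q ℚ.≟ 0ℚ
... | yes _ = sym (*-zeroʳ p)
... | no _ = cong (p *_) (sym (*-identityˡ _))

*-recipʳ : ∀ {q} → 0ℚ ℚ.< q → q * recip q ≡ 1ℚ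
*-recipʳ {q} 0<q with q ℚ.≟ 0ℚ
... | yes q≡0 = contradiction (sym q≡0) (ℚ.<⇒≢ 0<q)
... | no q≢0 = trans (cong (q *_) (*-identityˡ _)) (ℚ.*-inverseʳ q {{ℚ.≢-nonZero q≢0}})

recip-nonNeg : ∀ {q} → 0ℚ ℚ.≤ q → 0ℚ ℚ.≤ recip q
recip-nonNeg {q} 0≤q with q ℚ.≟ 0ℚ
... | yes _ = ≤-refl
... | no q≢0 = ≤-trans (<⇒≤ (ℚ.positive⁻¹ (1/ q) {{1/q>0}})) (≤-reflexive (sym (*-identityˡ (1/ q))))
  where
  instance
    _ : ℚ.NonZero q
    _ = ℚ.≢-nonZero q≢0
  1/q>0 : ℚ.Positive (1/ q)
  1/q>0 = ℚ.1/pos⇒pos q {{ℚ.nonNeg∧nonZero⇒pos q {{ℚ.nonNegative 0≤q}}}}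

÷'-nonNeg : ∀ {p q} → 0ℚ ℚ.≤ p → 0ℚ ℚ.≤ q → 0ℚ ℚ.≤ p ÷' q
÷'-nonNeg {p} {q} 0≤p 0≤q = subst (0ℚ ℚ.≤_) (sym (÷'≡*recip p q)) (*-nonNeg 0≤p (recip-nonNeg 0≤q))

÷'-*-cancel : ∀ p {q} → 0ℚ ℚ.< q → (p ÷' q) * q ≡ p
÷'-*-cancel p {q} 0<q = begin
  (p ÷' q) * q        ≡⟨ cong (_* q) (÷'≡*recip p q) ⟩
  p * recip q * q     ≡⟨ *-Properties.xy∙z≈x∙zy p (recip q) q ⟩
  p * (q * recip q)   ≡⟨ cong (p *_) (*-recipʳ 0<q) ⟩
  p * 1ℚ              ≡⟨ *-identityʳ p ⟩
  p                   ∎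
  where open ≡-Reasoning

recip-* : ∀ {p q} → 0ℚ ℚ.< p → 0ℚ ℚ.< q → recip (p * q) ≡ recip p * recip q
recip-* {p} {q} 0<p 0<q = begin
  recip (p * q)                                   ≡⟨ sym (*-identityʳ _) ⟩
  recip (p * q) * 1ℚ                              ≡⟨ cong (recip (p * q) *_) (sym ones) ⟩
  recip (p * q) * ((p * recip p) * (q * recip q))
    ≡⟨ solve 5 (λ x a b c d → x :* ((a :* c) :* (b :* d)) := ((a :* b) :* x) :* (c :* d))
             refl (recip (p * q)) p q (recip p) (recip q) ⟩
  ((p * q) * recip (p * q)) * (recip p * recip q) ≡⟨ cong (_* (recip p * recip q)) (*-recipʳ (*-pos 0<p 0<q)) ⟩
  1ℚ * (recip p * recip q)                        ≡⟨ *-identityˡ _ ⟩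
  recip p * recip q                               ∎
  where
  open ≡-Reasoning
  ones : (p * recip p) * (q * recip q) ≡ 1ℚ
  ones = cong₂ _*_ (*-recipʳ 0<p) (*-recipʳ 0<q)

∑ : ℕ → (ℕ → ℚ) → ℚ
∑ zero f = 0ℚ
∑ (suc N) f = f 0 + ∑ N (f ∘ suc)

syntax ∑ N (λ i → e) = ∑[ i < N ] e

∑-cong : ∀ N {f g : ℕ → ℚ} → (∀ i → f i ≡ g i) → ∑ N f ≡ ∑ N g
∑-cong zero f≗g = refl
∑-cong (suc N) f≗g = cong₂ _+_ (f≗g 0) (∑-cong N (f≗g ∘ suc))

∑-mono-≤ : ∀ N {f g : ℕ → ℚ} → (∀ {i} → i < N → f i ℚ.≤ g i) → ∑ N f ℚ.≤ ∑ N g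
∑-mono-≤ zero f≤g = ≤-refl
∑-mono-≤ (suc N) f≤g = +-mono-≤ (f≤g (s≤s z≤n)) (∑-mono-≤ N (f≤g ∘ s≤s))

∑-nonNeg : ∀ N {f : ℕ → ℚ} → (∀ i → 0ℚ ℚ.≤ f i) → 0ℚ ℚ.≤ ∑ N f
∑-nonNeg zero f≥0 = ≤-refl
∑-nonNeg (suc N) f≥0 = +-nonNeg (f≥0 0) (∑-nonNeg N (f≥0 ∘ suc))

∑-+ : ∀ N (f g : ℕ → ℚ) → ∑[ i < N ] (f i + g i) ≡ ∑ N f + ∑ N g
∑-+ zero f g = sym (ℚ.+-identityˡ 0ℚ)
∑-+ (suc N) f g = trans (cong ((f 0 + g 0) +_) (∑-+ N (f ∘ suc) (g ∘ suc)))
                        (+-Properties.interchange (f 0) (g 0) (∑ N (f ∘ suc)) (∑ N (g ∘ suc)))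

*-distribˡ-∑ : ∀ N c (f : ℕ → ℚ) → c * ∑ N f ≡ ∑[ i < N ] (c * f i)
*-distribˡ-∑ zero c f = *-zeroʳ c
*-distribˡ-∑ (suc N) c f = trans (ℚ.*-distribˡ-+ c (f 0) _) (cong (c * f 0 +_) (*-distribˡ-∑ N c (f ∘ suc)))

*-distribʳ-∑ : ∀ N c (f : ℕ → ℚ) → ∑ N f * c ≡ ∑[ i < N ] (f i * c)
*-distribʳ-∑ N c f = trans (ℚ.*-comm (∑ N f) c)
  (trans (*-distribˡ-∑ N c f) (∑-cong N (λ i → ℚ.*-comm c (f i))))

∑-≤-∑-+ : ∀ N M {f : ℕ → ℚ} → (∀ i → 0ℚ ℚ.≤ f i) → ∑ N f ℚ.≤ ∑ (N ℕ.+ M) f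
∑-≤-∑-+ zero M f≥0 = ∑-nonNeg M f≥0
∑-≤-∑-+ (suc N) M {f} f≥0 = ℚ.+-monoʳ-≤ (f 0) (∑-≤-∑-+ N M (f≥0 ∘ suc))

∑-+-weighted-tail≡weighted-∑ : ∀ N (f : ℕ → ℚ) →
  ∑ (suc N) f + ∑[ i < N ] (toℚ (suc i) * f (suc i)) ≡ ∑[ i < suc N ] (toℚ (suc i) * f i)
∑-+-weighted-tail≡weighted-∑ N f = begin
  (f 0 + ∑ N (f ∘ suc)) + ∑[ i < N ] (toℚ (suc i) * f (suc i))
    ≡⟨ ℚ.+-assoc (f 0) _ _ ⟩
  f 0 + (∑ N (f ∘ suc) + ∑[ i < N ] (toℚ (suc i) * f (suc i)))
    ≡⟨ cong₂ _+_ (sym (*-identityˡ (f 0))) (sym (∑-+ N (f ∘ suc) _)) ⟩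
  1ℚ * f 0 + ∑[ i < N ] (f (suc i) + toℚ (suc i) * f (suc i))
    ≡⟨ cong (1ℚ * f 0 +_) (∑-cong N λ i → trans (one-more (f (suc i)) (toℚ (suc i)))
                                                (cong (_* f (suc i)) (sym (toℚ-+ 1 (suc i))))) ⟩
  1ℚ * f 0 + ∑[ i < N ] (toℚ (suc (suc i)) * f (suc i))
    ∎
  where
  open ≡-Reasoning
  one-more : ∀ x c → x + c * x ≡ (1ℚ + c) * x
  one-more x c = trans (cong (_+ c * x) (sym (*-identityˡ x))) (sym (ℚ.*-distribʳ-+ x 1ℚ c))

∑-range : ∀ (h : ℕ → ℚ) a b → sumℚ (map h (range a b)) ≡ ∑[ i < suc b ∸ a ] h (a ℕ.+ i)
∑-range h a b = trans (cong sumℚ (sym (List.map-∘ (applyUpTo (λ i → i) (suc b ∸ a)))))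
                      (sumℚ-applyUpTo (λ i → h (a ℕ.+ i)) (λ i → i) (suc b ∸ a))
  where
  sumℚ-applyUpTo : ∀ (f : ℕ → ℚ) (g : ℕ → ℕ) N → sumℚ (map f (applyUpTo g N)) ≡ ∑ N (f ∘ g)
  sumℚ-applyUpTo f g zero = refl
  sumℚ-applyUpTo f g (suc N) = cong (f (g 0) +_) (sumℚ-applyUpTo f (g ∘ suc) N)

module _ {A : Set} where

  toℚ-sumℕ : ∀ (f : A → ℕ) xs → toℚ (sumℕ (map f xs)) ≡ sumℚ (map (toℚ ∘ f) xs)
  toℚ-sumℕ f [] = refl
  toℚ-sumℕ f (x ∷ xs) = trans (toℚ-+ (f x) (sumℕ (map f xs))) (cong (toℚ (f x) +_) (toℚ-sumℕ f xs))

  sumℕ-filter-≤ : ∀ (f : A → ℕ) p xs → sumℕ (map f (filterᵇ p xs)) ≤ sumℕ (map f xs)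
  sumℕ-filter-≤ f p [] = z≤n
  sumℕ-filter-≤ f p (x ∷ xs) with p x
  ... | true = ℕₚ.+-monoʳ-≤ (f x) (sumℕ-filter-≤ f p xs)
  ... | false = ℕₚ.≤-trans (sumℕ-filter-≤ f p xs) (ℕₚ.m≤n+m _ (f x))

  sumℚ-nonNeg : ∀ (f : A → ℚ) xs → (∀ x → 0ℚ ℚ.≤ f x) → 0ℚ ℚ.≤ sumℚ (map f xs)
  sumℚ-nonNeg f [] f≥0 = ≤-refl
  sumℚ-nonNeg f (x ∷ xs) f≥0 = +-nonNeg (f≥0 x) (sumℚ-nonNeg f xs f≥0)

  sumℚ-mono-≤ : ∀ {f g : A → ℚ} xs → (∀ x → f x ℚ.≤ g x) → sumℚ (map f xs) ℚ.≤ sumℚ (map g xs)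
  sumℚ-mono-≤ [] f≤g = ≤-refl
  sumℚ-mono-≤ (x ∷ xs) f≤g = +-mono-≤ (f≤g x) (sumℚ-mono-≤ xs f≤g)

  sumℚ-+ : ∀ (f g : A → ℚ) xs → sumℚ (map (λ x → f x + g x) xs) ≡ sumℚ (map f xs) + sumℚ (map g xs)
  sumℚ-+ f g [] = sym (ℚ.+-identityˡ 0ℚ)
  sumℚ-+ f g (x ∷ xs) = trans (cong ((f x + g x) +_) (sumℚ-+ f g xs))
                              (+-Properties.interchange (f x) (g x) (sumℚ (map f xs)) (sumℚ (map g xs)))

  *-distribˡ-sumℚ : ∀ c (f : A → ℚ) xs → c * sumℚ (map f xs) ≡ sumℚ (map (λ x → c * f x) xs)
  *-distribˡ-sumℚ c f [] = *-zeroʳ c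
  *-distribˡ-sumℚ c f (x ∷ xs) = trans (ℚ.*-distribˡ-+ c (f x) _) (cong (c * f x +_) (*-distribˡ-sumℚ c f xs))

  sumℚ-∑ : ∀ N (h : A → ℕ → ℚ) xs →
    sumℚ (map (λ x → ∑ N (h x)) xs) ≡ ∑[ i < N ] sumℚ (map (λ x → h x i) xs)
  sumℚ-∑ N h [] = sym (∑-zero N)
    where
    ∑-zero : ∀ N → ∑[ i < N ] 0ℚ ≡ 0ℚ
    ∑-zero zero = refl
    ∑-zero (suc N) = trans (ℚ.+-identityˡ _) (∑-zero N)
  sumℚ-∑ N h (x ∷ xs) = trans (cong (∑ N (h x) +_) (sumℚ-∑ N h xs)) (sym (∑-+ N (h x) _))

module _ {A : Set} where

  if-elim : ∀ (P : A → Set) {b x y} → P x → P y → P (if b then x else y)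
  if-elim P {true} px py = px
  if-elim P {false} px py = py

  if-T : ∀ {b} {x y : A} → T b → (if b then x else y) ≡ x
  if-T {true} _ = refl

  if-¬T : ∀ {b} {x y : A} → ¬ T b → (if b then x else y) ≡ y
  if-¬T {true} ¬b = contradiction _ ¬b
  if-¬T {false} _ = refl

T-∧⁺ : ∀ {a b} → T a → T b → T (a ∧ b)
T-∧⁺ {a} ta tb = Equivalence.from (T-∧ {a}) (ta , tb)

T-not⇒¬T : ∀ {b} → T (not b) → ¬ T b
T-not⇒¬T {false} _ ()

T-not-∨⇒ : ∀ {b c} → T (not b ∨ c) → T b → T c
T-not-∨⇒ {true} c _ = c

⇒T-not-∨ : ∀ {b c} → (T b → T c) → T (not b ∨ c)
⇒T-not-∨ {true} b⇒c = b⇒c _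
⇒T-not-∨ {false} _ = _

module _ {n : ℕ} where

  above⇒< : ∀ {v : Fin n} {σ x} → T (above v σ) → x ∈ σ → toℕ v < toℕ x
  above⇒< {v} {σ} {x} v<σ x∈σ = ℕₚ.<ᵇ⇒< (toℕ v) (toℕ x) (T-not-∨⇒ {x ∈ᵇ σ} v<x (fromWitness x∈σ))
    where
    v<x : T (not (x ∈ᵇ σ) ∨ (toℕ v ℕ.<ᵇ toℕ x))
    v<x = All.lookup (all⁺ (λ y → not (y ∈ᵇ σ) ∨ (toℕ v ℕ.<ᵇ toℕ y)) (allFin n) v<σ) (∈-allFin x)

  <⇒above : ∀ {v : Fin n} {σ} → (∀ {x} → x ∈ σ → toℕ v < toℕ x) → T (above v σ)
  <⇒above {v} {σ} v<σ = all⁻ (λ y → not (y ∈ᵇ σ) ∨ (toℕ v ℕ.<ᵇ toℕ y)) {allFin n}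
    (All.tabulate λ {x} _ → ⇒T-not-∨ {x ∈ᵇ σ} λ x∈σ → ℕₚ.<⇒<ᵇ (v<σ (toWitness x∈σ)))

x∉p─q : ∀ {n} {x : Fin n} p q → x ∈ q → x ∉ p ─ q
x∉p─q (_ ∷ p) (inside ∷ q) Vec.here ()
x∉p─q (_ ∷ p) (_ ∷ q) (Vec.there x∈q) (Vec.there x∈p─q) = x∉p─q p q x∈q x∈p─q

x∉p-x : ∀ {n} (p : Subset n) x → x ∉ p - x
x∉p-x p x = x∉p─q p ⁅ x ⁆ (Subsetₚ.x∈⁅x⁆ x)

module _ {n : ℕ} {σ e : Subset n} {v : Fin n} where

  ⊆-x⇒∉ : σ ⊆ e - v → v ∉ σ
  ⊆-x⇒∉ σ⊆e-v v∈σ = x∉p-x e v (σ⊆e-v v∈σ)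

  ⊆-x⇒∪⁅x⁆⊆ : σ ⊆ e - v → v ∈ e → σ ∪ ⁅ v ⁆ ⊆ e
  ⊆-x⇒∪⁅x⁆⊆ σ⊆e-v v∈e x∈ with Subsetₚ.x∈p∪q⁻ σ ⁅ v ⁆ x∈
  ... | inj₁ x∈σ = Subsetₚ.p─q⊆p e ⁅ v ⁆ (σ⊆e-v x∈σ)
  ... | inj₂ x∈⁅v⁆ rewrite Subsetₚ.x∈⁅y⁆⇒x≡y v x∈⁅v⁆ = v∈e

∣p∪⁅x⁆∣≡1+∣p∣ : ∀ {n} (p : Subset n) x → x ∉ p → ∣ p ∪ ⁅ x ⁆ ∣ ≡ suc ∣ p ∣
∣p∪⁅x⁆∣≡1+∣p∣ (inside ∷ p) fzero x∉p = contradiction Vec.here x∉p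
∣p∪⁅x⁆∣≡1+∣p∣ (outside ∷ p) fzero _ = cong suc (cong ∣_∣ (Subsetₚ.∪-identityʳ p))
∣p∪⁅x⁆∣≡1+∣p∣ (inside ∷ p) (fsuc x) x∉p = cong suc (∣p∪⁅x⁆∣≡1+∣p∣ p x (x∉p ∘ Vec.there))
∣p∪⁅x⁆∣≡1+∣p∣ (outside ∷ p) (fsuc x) x∉p = ∣p∪⁅x⁆∣≡1+∣p∣ p x (x∉p ∘ Vec.there)

∈-allSubsets : ∀ {n} (σ : Subset n) → σ ∈ₗ allSubsets n
∈-allSubsets [] = here refl
∈-allSubsets {suc n} (outside ∷ σ) = ∈-++⁺ˡ (∈-map⁺ (outside ∷_) (∈-allSubsets σ))
∈-allSubsets {suc n} (inside ∷ σ) =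
  ∈-++⁺ʳ (map (outside ∷_) (allSubsets n)) (∈-map⁺ (inside ∷_) (∈-allSubsets σ))

module _ {A : Set} (f : A → ℕ) where

  maxℕ-filter-mono : ∀ (p q : A → Bool) xs → (∀ {x} → T (p x) → T (q x)) →
                     maxℕ (map f (filterᵇ p xs)) ≤ maxℕ (map f (filterᵇ q xs))
  maxℕ-filter-mono p q [] p⇒q = z≤n
  maxℕ-filter-mono p q (x ∷ xs) p⇒q with p x in px | q x in qx
  ... | true  | true  = ℕₚ.⊔-monoʳ-≤ (f x) (maxℕ-filter-mono p q xs p⇒q)
  ... | true  | false = ⊥-elim (subst T qx (p⇒q (subst T (sym px) _)))
  ... | false | true  = ℕₚ.≤-trans (maxℕ-filter-mono p q xs p⇒q) (ℕₚ.m≤n⊔m (f x) _)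
  ... | false | false = maxℕ-filter-mono p q xs p⇒q

  ≤-maxℕ-filter : ∀ (p : A → Bool) {x} xs → x ∈ₗ xs → T (p x) → f x ≤ maxℕ (map f (filterᵇ p xs))
  ≤-maxℕ-filter p (y ∷ xs) (here refl) py with p y
  ... | true = ℕₚ.m≤m⊔n (f y) _
  ≤-maxℕ-filter p (y ∷ xs) (there x∈xs) px with p y
  ... | true = ℕₚ.≤-trans (≤-maxℕ-filter p xs x∈xs px) (ℕₚ.m≤n⊔m (f y) _)
  ... | false = ≤-maxℕ-filter p xs x∈xs px

length-filter-≤-∷ : ∀ {A : Set} (q : A → Bool) x xs → length (filterᵇ q xs) ≤ length (filterᵇ q (x ∷ xs))
length-filter-≤-∷ q x xs with q x
... | true = ℕₚ.n≤1+n _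
... | false = ℕₚ.≤-refl

module _ {A B : Set} (g : A → B) (p : A → Bool) (q : B → Bool) where

  count-map-filter-≤ : ∀ (q′ : A → Bool) xs → (∀ {e} → T (p e) → T (q (g e)) → T (q′ e)) →
    length (filterᵇ q (map g (filterᵇ p xs))) ≤ length (filterᵇ q′ xs)
  count-map-filter-≤ q′ [] _ = z≤n
  count-map-filter-≤ q′ (e ∷ xs) imp with p e in pe
  ... | false = ℕₚ.≤-trans (count-map-filter-≤ q′ xs imp) (length-filter-≤-∷ q′ e xs)
  ... | true with q (g e) in qe | q′ e in q′e
  ...   | true  | true  = s≤s (count-map-filter-≤ q′ xs imp)
  ...   | true  | false = ⊥-elim (subst T q′e (imp (subst T (sym pe) _) (subst T (sym qe) _)))
  ...   | false | true  = ℕₚ.m≤n⇒m≤1+n (count-map-filter-≤ q′ xs imp)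
  ...   | false | false = count-map-filter-≤ q′ xs imp

  count-map-filter-0⊎ : ∀ xs →
    length (filterᵇ q (map g (filterᵇ p xs))) ≡ 0 ⊎ ∃ λ e → T (p e) × T (q (g e))
  count-map-filter-0⊎ [] = inj₁ refl
  count-map-filter-0⊎ (e ∷ xs) with p e in pe
  ... | false = count-map-filter-0⊎ xs
  ... | true with q (g e) in qe
  ...   | true = inj₂ (e , subst T (sym pe) _ , subst T (sym qe) _)
  ...   | false = count-map-filter-0⊎ xs

module _ {r n : ℕ} (G : Hypergraph r n) where

  dList-++ : ∀ xs ys σ → dList G (xs ++ ys) σ ≡ dList G xs σ ℕ.+ dList G ys σ
  dList-++ xs ys σ = trans (cong length (List.filter-++ _ xs ys)) (List.length-++ (filterᵇ (σ ⊆ᵇ_) xs))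

  degMax-anti : ∀ j {σ σ′ : Subset n} → σ ⊆ σ′ → degMax G j σ′ ≤ degMax G j σ
  degMax-anti j {σ} {σ′} σ⊆σ′ = maxℕ-filter-mono (deg G) _ _ (allSubsets n) weaken
    where
    weaken : ∀ {x} → T ((σ′ ⊆ᵇ x) ∧ (∣ x ∣ ℕ.≡ᵇ j)) → T ((σ ⊆ᵇ x) ∧ (∣ x ∣ ℕ.≡ᵇ j))
    weaken {x} h with Equivalence.to (T-∧ {σ′ ⊆ᵇ x}) h
    ... | σ′⊆x , ∣x∣≡j =
      Equivalence.from (T-∧ {σ ⊆ᵇ x}) (fromWitness (λ {y} → Subsetₚ.⊆-trans σ⊆σ′ (toWitness σ′⊆x) {y}) , ∣x∣≡j)

  deg≤degMax : ∀ {σ σ′ : Subset n} → σ ⊆ σ′ → deg G σ′ ≤ degMax G ∣ σ′ ∣ σ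
  deg≤degMax {σ} {σ′} σ⊆σ′ = ≤-maxℕ-filter (deg G) _ (allSubsets n) (∈-allSubsets σ′)
    (Equivalence.from (T-∧ {σ ⊆ᵇ σ′}) (fromWitness (λ {x} → σ⊆σ′ {x}) , ℕₚ.≡⇒≡ᵇ ∣ σ′ ∣ ∣ σ′ ∣ refl))

[1+m]C2≡m+mC2 : ∀ m → suc m C 2 ≡ m ℕ.+ m C 2
[1+m]C2≡m+mC2 m = trans (sym (nCk+nC[k+1]≡[n+1]C[k+1] m 1)) (cong (ℕ._+ m C 2) (nC1≡n m))

1≤rC2 : ∀ {r} → 2 ≤ r → 1 ≤ r C 2
1≤rC2 {suc zero} (s≤s ())
1≤rC2 {suc (suc r)} _ =
  ℕₚ.≤-trans (s≤s z≤n) (ℕₚ.≤-trans (ℕₚ.m≤m+n (suc r) _) (ℕₚ.≤-reflexive (sym ([1+m]C2≡m+mC2 (suc r)))))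

1+n≤2^n : ∀ n → suc n ≤ 2 ℕ.^ n
1+n≤2^n zero = ℕₚ.≤-refl
1+n≤2^n (suc n) = begin
  2 ℕ.+ n            ≤⟨ ℕₚ.+-monoʳ-≤ 2 (ℕₚ.m≤m+n n n) ⟩
  2 ℕ.+ (n ℕ.+ n)    ≡⟨ double n ⟩
  2 ℕ.* suc n        ≤⟨ ℕₚ.*-monoʳ-≤ 2 (1+n≤2^n n) ⟩
  2 ℕ.* 2 ℕ.^ n      ∎
  where
  open ℕₚ.≤-Reasoning
  double : ∀ n → 2 ℕ.+ (n ℕ.+ n) ≡ 2 ℕ.* suc n
  double = ℕ-Ring.solve-∀

-- The exponent gap C(2+s+ℓ, 2) - C(1+ℓ, 2) = (ℓ+1) + (ℓ+2) + ⋯ + (ℓ+s+1): its first term pays for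
-- the factor 2(ℓ+1), each later one for a factor 4.
2[1+ℓ]4^s2^[1+ℓ]C2≤2^[2+s+ℓ]C2 : ∀ s ℓ →
  2 ℕ.* suc ℓ ℕ.* 4 ℕ.^ s ℕ.* 2 ℕ.^ (suc ℓ C 2) ≤ 2 ℕ.^ ((2 ℕ.+ s ℕ.+ ℓ) C 2)
2[1+ℓ]4^s2^[1+ℓ]C2≤2^[2+s+ℓ]C2 zero ℓ = begin
  2 ℕ.* suc ℓ ℕ.* 1 ℕ.* 2 ℕ.^ F   ≡⟨ cong (ℕ._* 2 ℕ.^ F) (ℕₚ.*-identityʳ (2 ℕ.* suc ℓ)) ⟩
  2 ℕ.* suc ℓ ℕ.* 2 ℕ.^ F         ≤⟨ ℕₚ.*-monoˡ-≤ (2 ℕ.^ F) (ℕₚ.*-monoʳ-≤ 2 (1+n≤2^n ℓ)) ⟩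
  2 ℕ.^ suc ℓ ℕ.* 2 ℕ.^ F         ≡⟨ sym (ℕₚ.^-distribˡ-+-* 2 (suc ℓ) F) ⟩
  2 ℕ.^ (suc ℓ ℕ.+ F)             ≡⟨ cong (2 ℕ.^_) (sym ([1+m]C2≡m+mC2 (suc ℓ))) ⟩
  2 ℕ.^ (suc (suc ℓ) C 2)         ∎
  where
  open ℕₚ.≤-Reasoning
  F : ℕ
  F = suc ℓ C 2
2[1+ℓ]4^s2^[1+ℓ]C2≤2^[2+s+ℓ]C2 (suc s) ℓ = begin
  2 ℕ.* suc ℓ ℕ.* (4 ℕ.* 4 ℕ.^ s) ℕ.* 2 ℕ.^ F   ≡⟨ pull-4 (suc ℓ) (4 ℕ.^ s) (2 ℕ.^ F) ⟩
  4 ℕ.* (2 ℕ.* suc ℓ ℕ.* 4 ℕ.^ s ℕ.* 2 ℕ.^ F)   ≤⟨ ℕₚ.*-monoʳ-≤ 4 (2[1+ℓ]4^s2^[1+ℓ]C2≤2^[2+s+ℓ]C2 s ℓ) ⟩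
  4 ℕ.* 2 ℕ.^ (M C 2)                           ≤⟨ ℕₚ.*-monoˡ-≤ (2 ℕ.^ (M C 2)) (ℕₚ.^-monoʳ-≤ 2 {2} {M} (s≤s (s≤s z≤n))) ⟩
  2 ℕ.^ M ℕ.* 2 ℕ.^ (M C 2)                     ≡⟨ sym (ℕₚ.^-distribˡ-+-* 2 M (M C 2)) ⟩
  2 ℕ.^ (M ℕ.+ M C 2)                           ≡⟨ cong (2 ℕ.^_) (sym ([1+m]C2≡m+mC2 M)) ⟩
  2 ℕ.^ (suc M C 2)                             ∎
  where
  open ℕₚ.≤-Reasoning
  F M : ℕ
  F = suc ℓ C 2
  M = 2 ℕ.+ s ℕ.+ ℓ
  pull-4 : ∀ a b c → 2 ℕ.* a ℕ.* (4 ℕ.* b) ℕ.* c ≡ 4 ℕ.* (2 ℕ.* a ℕ.* b ℕ.* c)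
  pull-4 = ℕ-Ring.solve-∀

*-recip-cancel : ∀ x {q} y → 0ℚ ℚ.< q → x * recip q * (q * y) ≡ x * y
*-recip-cancel x {q} y 0<q = begin
  x * recip q * (q * y)    ≡⟨ solve 4 (λ a b c d → a :* b :* (c :* d) := a :* d :* (c :* b)) refl x (recip q) q y ⟩
  x * y * (q * recip q)    ≡⟨ cong (x * y *_) (*-recipʳ 0<q) ⟩
  x * y * 1ℚ               ≡⟨ *-identityʳ (x * y) ⟩
  x * y                    ∎
  where open ≡-Reasoning

toℚ-frac-≤ : ∀ a b c d → 0 < b → 0 < d → a ℕ.* d ≤ c ℕ.* b →
             toℚ a * recip (toℚ b) ℚ.≤ toℚ c * recip (toℚ d)
toℚ-frac-≤ a b c d 0<b 0<d ad≤cb = ℚ.*-cancelʳ-≤-pos (toℚ b * toℚ d) {{ℚ.positive 0<bd}} (begin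
  toℚ a * recip (toℚ b) * (toℚ b * toℚ d)   ≡⟨ *-recip-cancel (toℚ a) (toℚ d) (toℚ-pos 0<b) ⟩
  toℚ a * toℚ d                             ≡⟨ sym (toℚ-* a d) ⟩
  toℚ (a ℕ.* d)                             ≤⟨ toℚ-mono-≤ ad≤cb ⟩
  toℚ (c ℕ.* b)                             ≡⟨ toℚ-* c b ⟩
  toℚ c * toℚ b                             ≡⟨ sym (*-recip-cancel (toℚ c) (toℚ b) (toℚ-pos 0<d)) ⟩
  toℚ c * recip (toℚ d) * (toℚ d * toℚ b)   ≡⟨ cong (toℚ c * recip (toℚ d) *_) (ℚ.*-comm (toℚ d) (toℚ b)) ⟩
  toℚ c * recip (toℚ d) * (toℚ b * toℚ d)   ∎)
  where
  open ℚ.≤-Reasoning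
  0<bd : 0ℚ ℚ.< toℚ b * toℚ d
  0<bd = *-pos (toℚ-pos 0<b) (toℚ-pos 0<d)

weight-ratio-≤ : ∀ {r} s ℓ → 1 ≤ s → 2 ≤ r →
  toℚ 2 ^ℚ (r C 2) * toℚ (suc ℓ) * recip (toℚ 2 ^ℚ ((suc s ℕ.+ ℓ) C 2))
    ℚ.≤ recip (toℚ 4 ^ℚ (s ∸ 1)) * toℚ 2 ^ℚ ((r C 2) ∸ 1) * recip (toℚ 2 ^ℚ (suc ℓ C 2))
weight-ratio-≤ {r} (suc s) ℓ _ 2≤r with r C 2 | 1≤rC2 2≤r
... | suc c | _ = begin
  toℚ 2 ^ℚ suc c * toℚ (suc ℓ) * recip (toℚ 2 ^ℚ E)
    ≡⟨ cong₂ (λ x y → x * toℚ (suc ℓ) * recip y) (toℚ-^ 2 (suc c)) (toℚ-^ 2 E) ⟩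
  toℚ (2 ℕ.^ suc c) * toℚ (suc ℓ) * recip (toℚ (2 ℕ.^ E))
    ≡⟨ cong (_* recip (toℚ (2 ℕ.^ E))) (sym (toℚ-* (2 ℕ.^ suc c) (suc ℓ))) ⟩
  toℚ (2 ℕ.^ suc c ℕ.* suc ℓ) * recip (toℚ (2 ℕ.^ E))
    ≤⟨ toℚ-frac-≤ (2 ℕ.^ suc c ℕ.* suc ℓ) (2 ℕ.^ E) (2 ℕ.^ c) (4 ℕ.^ s ℕ.* 2 ℕ.^ F)
                  (ℕₚ.m^n>0 2 E) (ℕₚ.*-mono-< (ℕₚ.m^n>0 4 s) (ℕₚ.m^n>0 2 F)) cross-≤ ⟩
  toℚ (2 ℕ.^ c) * recip (toℚ (4 ℕ.^ s ℕ.* 2 ℕ.^ F))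
    ≡⟨ cong (λ x → toℚ (2 ℕ.^ c) * recip x) (toℚ-* (4 ℕ.^ s) (2 ℕ.^ F)) ⟩
  toℚ (2 ℕ.^ c) * recip (toℚ (4 ℕ.^ s) * toℚ (2 ℕ.^ F))
    ≡⟨ cong (toℚ (2 ℕ.^ c) *_) (recip-* (toℚ-pos (ℕₚ.m^n>0 4 s)) (toℚ-pos (ℕₚ.m^n>0 2 F))) ⟩
  toℚ (2 ℕ.^ c) * (recip (toℚ (4 ℕ.^ s)) * recip (toℚ (2 ℕ.^ F)))
    ≡⟨ *-Properties.x∙yz≈yx∙z (toℚ (2 ℕ.^ c)) (recip (toℚ (4 ℕ.^ s))) (recip (toℚ (2 ℕ.^ F))) ⟩
  recip (toℚ (4 ℕ.^ s)) * toℚ (2 ℕ.^ c) * recip (toℚ (2 ℕ.^ F))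
    ≡⟨ sym (cong₂ (λ x z → recip x * toℚ (2 ℕ.^ c) * recip z) (toℚ-^ 4 s) (toℚ-^ 2 F)) ⟩
  recip (toℚ 4 ^ℚ s) * toℚ (2 ℕ.^ c) * recip (toℚ 2 ^ℚ F)
    ≡⟨ cong (λ y → recip (toℚ 4 ^ℚ s) * y * recip (toℚ 2 ^ℚ F)) (sym (toℚ-^ 2 c)) ⟩
  recip (toℚ 4 ^ℚ s) * toℚ 2 ^ℚ c * recip (toℚ 2 ^ℚ F)
    ∎
  where
  open ℚ.≤-Reasoning
  E F : ℕ
  E = (2 ℕ.+ s ℕ.+ ℓ) C 2
  F = suc ℓ C 2
  cross-≤ : 2 ℕ.^ suc c ℕ.* suc ℓ ℕ.* (4 ℕ.^ s ℕ.* 2 ℕ.^ F) ≤ 2 ℕ.^ c ℕ.* 2 ℕ.^ E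
  cross-≤ = ℕₚ.≤-trans (ℕₚ.≤-reflexive (pull-2^c (2 ℕ.^ c) (suc ℓ) (4 ℕ.^ s) (2 ℕ.^ F)))
                       (ℕₚ.*-monoʳ-≤ (2 ℕ.^ c) (2[1+ℓ]4^s2^[1+ℓ]C2≤2^[2+s+ℓ]C2 s ℓ))
    where
    pull-2^c : ∀ x a b d → 2 ℕ.* x ℕ.* a ℕ.* (b ℕ.* d) ≡ x ℕ.* (2 ℕ.* a ℕ.* b ℕ.* d)
    pull-2^c = ℕ-Ring.solve-∀

module Weights {r n : ℕ} (G : Hypergraph r n) (τ : ℚ) where

  prefactor : ℕ → ℚ
  prefactor t = toℚ 2 ^ℚ (r C 2) * τ ^ℚ (r ∸ t)

  weight : ℕ → ℕ → ℚ
  weight t ℓ = recip (toℚ 2 ^ℚ ((t ℕ.+ ℓ) C 2)) * recip (τ ^ℚ ℓ)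

  weightedDeg : ℕ → Subset n → ℕ → ℚ
  weightedDeg t σ ℓ = weight t ℓ * toℚ (degMax G (∣ σ ∣ ℕ.+ ℓ) σ)

  θ-singleton : ∀ t {σ} → ∣ σ ∣ ≡ 1 → θ G τ t σ ≡ τ ^ℚ (r ∸ t) * toℚ (deg G σ)
  θ-singleton t ∣σ∣≡1 = if-T (ℕₚ.≡⇒≡ᵇ _ 1 ∣σ∣≡1)

  θ-expand : ∀ t {σ} → 2 ≤ ∣ σ ∣ → θ G τ t σ ≡ prefactor t * ∑[ ℓ < suc (r ∸ t) ] weightedDeg t σ ℓ
  θ-expand t {σ} 2≤∣σ∣ = trans (if-¬T ∣σ∣≢1) (cong (prefactor t *_) (∑-range (weightedDeg t σ) 0 (r ∸ t)))
    where
    ∣σ∣≢1 : ¬ T (∣ σ ∣ ℕ.≡ᵇ 1)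
    ∣σ∣≢1 h = ℕₚ.<⇒≢ 2≤∣σ∣ (sym (ℕₚ.≡ᵇ⇒≡ ∣ σ ∣ 1 h))

  module _ (0≤τ : 0ℚ ℚ.≤ τ) where

    prefactor-nonNeg : ∀ t → 0ℚ ℚ.≤ prefactor t
    prefactor-nonNeg t = *-nonNeg (^ℚ-nonNeg (r C 2) (toℚ-nonNeg 2)) (^ℚ-nonNeg (r ∸ t) 0≤τ)

    weight-nonNeg : ∀ t ℓ → 0ℚ ℚ.≤ weight t ℓ
    weight-nonNeg t ℓ =
      *-nonNeg (recip-nonNeg (^ℚ-nonNeg ((t ℕ.+ ℓ) C 2) (toℚ-nonNeg 2))) (recip-nonNeg (^ℚ-nonNeg ℓ 0≤τ))

    weightedDeg-nonNeg : ∀ t σ ℓ → 0ℚ ℚ.≤ weightedDeg t σ ℓ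
    weightedDeg-nonNeg t σ ℓ = *-nonNeg (weight-nonNeg t ℓ) (toℚ-nonNeg (degMax G (∣ σ ∣ ℕ.+ ℓ) σ))

    θ-nonNeg : ∀ t σ → 0ℚ ℚ.≤ θ G τ t σ
    θ-nonNeg t σ = if-elim (0ℚ ℚ.≤_)
      (*-nonNeg (^ℚ-nonNeg (r ∸ t) 0≤τ) (toℚ-nonNeg (deg G σ)))
      (*-nonNeg (prefactor-nonNeg t) (sumℚ-nonNeg (weightedDeg t σ) (range 0 (r ∸ t)) (weightedDeg-nonNeg t σ)))

Consecutive : ∀ {n} → ℕ → List (Fin n) → Set
Consecutive k [] = ⊤
Consecutive k (x ∷ xs) = toℕ x ≡ k × Consecutive (suc k) xs

tabulate-consecutive : ∀ {n} m (f : Fin m → Fin n) k → (∀ i → toℕ (f i) ≡ k ℕ.+ toℕ i) →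
                       Consecutive k (tabulate f)
tabulate-consecutive zero f k _ = _
tabulate-consecutive (suc m) f k f≗k+ =
  trans (f≗k+ fzero) (ℕₚ.+-identityʳ k) ,
  tabulate-consecutive m (f ∘ fsuc) (suc k) (λ i → trans (f≗k+ (fsuc i)) (ℕₚ.+-suc k (toℕ i)))

allFin-consecutive : ∀ n → Consecutive 0 (allFin n)
allFin-consecutive n = tabulate-consecutive n (λ i → i) 0 (λ _ → refl)

-- T and C only decide which vertices update P and Γ; the invariants below depend on P and Γ alone.
SameLists : ∀ {n} → State n → State n → Set
SameLists st st′ = P st ≡ P st′ × Γ st ≡ Γ st′

modeAction-keeps-lists : ∀ {r n} (G : Hypergraph r n) τ ζ (mode : Mode n) st v →
                         SameLists st (Container.modeAction G τ ζ mode st v)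
modeAction-keeps-lists G τ ζ (prune I) st v = if-elim (SameLists st) {v ∈ᵇ I} (refl , refl) (refl , refl)
modeAction-keeps-lists G τ ζ (build T₀) st v = if-elim (SameLists st) {v ∈ᵇ State.T st} (refl , refl) (refl , refl)

module Invariants {r n : ℕ} (G : Hypergraph r n) (τ ζ : ℚ) (mode : Mode n) where
  open Container G τ ζ mode

  -- The pairs (t, σ) for which the algorithm compares d_t(σ) with θ_t(σ).
  record Tracked (t : ℕ) (σ : Subset n) : Set where
    field
      1≤t : 1 ≤ t
      t<r : t < r
      1≤∣σ∣ : 1 ≤ ∣ σ ∣
      ∣σ∣≤t : ∣ σ ∣ ≤ t

    in-range : T (inRange t)
    in-range = Equivalence.from (T-∧ {1 ℕ.≤ᵇ t}) (ℕₚ.≤⇒≤ᵇ 1≤t , ℕₚ.≤⇒≤ᵇ (≤-pred∸1 t<r))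
      where
      ≤-pred∸1 : ∀ {m k} → m < k → m ≤ k ∸ 1
      ≤-pred∸1 (s≤s m≤k) = m≤k

  open Tracked

  Pfull-r : ∀ st → Pfull st r ≡ edges G
  Pfull-r st = if-T (ℕₚ.≡⇒≡ᵇ r r refl)

  Pfull-< : ∀ st {t} → t < r → Pfull st t ≡ P st t
  Pfull-< st t<r = if-¬T (λ t≡r → ℕₚ.<⇒≢ t<r (ℕₚ.≡ᵇ⇒≡ _ r t≡r))

  update-cong : ∀ {st st′} v → SameLists st st′ → SameLists (update st v) (update st′ v)
  update-cong {record {}} {record {}} v (refl , refl) = refl , refl

  step-lists : ∀ st v → SameLists st (step st v) ⊎ SameLists (update st v) (step st v)
  step-lists st v = if-elim Q {cond st v}
    (if-elim Q {v ∈ᵇ State.T (modeAction st v)} (inj₂ (update-cong {st} {modeAction st v} v keeps)) (inj₁ keeps))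
    (inj₁ (refl , refl))
    where
    Q : State n → Set
    Q st′ = SameLists st st′ ⊎ SameLists (update st v) st′
    keeps : SameLists st (modeAction st v)
    keeps = modeAction-keeps-lists G τ ζ mode st v

  AllFrom : ℕ → Subset n → Set
  AllFrom k σ = ∀ {x} → x ∈ σ → k ≤ toℕ x

  BelowThreshold : ℕ → State n → Set
  BelowThreshold k st = ∀ {t σ} → Tracked t σ → ¬ σ ∈ₗ Γ st t → AllFrom k σ →
                        toℚ (dList G (P st t) σ) ℚ.≤ θ G τ t σ

  CodegreeBounded : State n → Set
  CodegreeBounded st = ∀ {t σ B} → Tracked t σ → 0ℚ ℚ.≤ B →
    (∀ {v} → v ∉ σ → toℚ (dList G (Pfull st (suc t)) (σ ∪ ⁅ v ⁆)) ℚ.≤ B) →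
    toℚ (dList G (P st t) σ) ℚ.≤ θ G τ t σ + B

  BelowThreshold-resp : ∀ {k st st′} → SameLists st st′ → BelowThreshold k st → BelowThreshold k st′
  BelowThreshold-resp {st = record {}} {record {}} (refl , refl) below = below

  CodegreeBounded-resp : ∀ {st st′} → SameLists st st′ → CodegreeBounded st → CodegreeBounded st′
  CodegreeBounded-resp {record {}} {record {}} (refl , refl) bounded = bounded

  -- F st v s = map (_- v) (filterᵇ (contributes st v s) (Pfull st (suc s))).
  contributes : State n → Fin n → ℕ → Subset n → Bool
  contributes st v s e = (v ∈ᵇ e) ∧ above v (e - v) ∧ not (any (λ γ → γ ⊆ᵇ (e - v)) (Γ st s))

  below-threshold-update : ∀ st v → BelowThreshold (suc (toℕ v)) (update st v)
  below-threshold-update st v {t} {σ} tr σ∉Γ′ σ>v = ℚ.<⇒≤ (ℚ.≰⇒> (σ∉Γ′ ∘ joins-Γ))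
    where
    joins-Γ : θ G τ t σ ℚ.≤ toℚ (dList G (P (update st v) t) σ) → σ ∈ₗ Γ (update st v) t
    joins-Γ θ≤d = subst (σ ∈ₗ_) (sym (if-T (in-range tr)))
      (∈-++⁺ʳ (Γ st t) (∈-filter⁺ (T? ∘ _) (∈-allSubsets σ)
        (T-∧⁺ {above v σ} (<⇒above σ>v) (T-∧⁺ {1 ℕ.≤ᵇ ∣ σ ∣} (ℕₚ.≤⇒≤ᵇ (1≤∣σ∣ tr))
          (T-∧⁺ {∣ σ ∣ ℕ.≤ᵇ t} (ℕₚ.≤⇒≤ᵇ (∣σ∣≤t tr)) (ℚ.≤⇒≤ᵇ θ≤d))))))

  dList-update : ∀ st v {t} σ → T (inRange t) →
                 dList G (P (update st v) t) σ ≡ dList G (P st t) σ ℕ.+ dList G (F st v t) σ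
  dList-update st v {t} σ t∈range = trans (cong (λ xs → dList G xs σ) (if-T t∈range)) (dList-++ G (P st t) (F st v t) σ)

  Pfull-grows : ∀ st v k σ → dList G (Pfull st k) σ ≤ dList G (Pfull (update st v) k) σ
  Pfull-grows st v k σ with k ℕ.≡ᵇ r
  ... | true = ℕₚ.≤-refl
  ... | false with inRange k
  ...   | true = ℕₚ.≤-trans (ℕₚ.m≤m+n _ _) (ℕₚ.≤-reflexive (sym (dList-++ G (P st k) (F st v k) σ)))
  ...   | false = ℕₚ.≤-refl

  F-count-≤ : ∀ st v t σ → dList G (F st v t) σ ≤ dList G (Pfull st (suc t)) (σ ∪ ⁅ v ⁆)
  F-count-≤ st v t σ =
    count-map-filter-≤ (_- v) (contributes st v t) (σ ⊆ᵇ_) ((σ ∪ ⁅ v ⁆) ⊆ᵇ_) (Pfull st (suc t)) joins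
    where
    joins : ∀ {e} → T (contributes st v t e) → T (σ ⊆ᵇ (e - v)) → T ((σ ∪ ⁅ v ⁆) ⊆ᵇ e)
    joins {e} e-contributes σ⊆e-v =
      fromWitness (λ {x} → ⊆-x⇒∪⁅x⁆⊆ (toWitness σ⊆e-v) (toWitness v∈e) {x})
      where
      v∈e : T (v ∈ᵇ e)
      v∈e = proj₁ (Equivalence.to (T-∧ {v ∈ᵇ e}) e-contributes)

  F-contains-σ⇒ : ∀ {st v t σ e} → T (contributes st v t e) → T (σ ⊆ᵇ (e - v)) →
                 ¬ σ ∈ₗ Γ st t × AllFrom (toℕ v) σ × v ∉ σ
  F-contains-σ⇒ {st} {v} {t} {σ} {e} e-contributes σ⊆ᵇe-v =
    (λ σ∈Γ → T-not⇒¬T untouched (any⁺ _ (lose σ∈Γ σ⊆ᵇe-v))) ,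
    (λ x∈σ → ℕₚ.<⇒≤ (above⇒< v<e-v (σ⊆e-v x∈σ))) ,
    ⊆-x⇒∉ σ⊆e-v
    where
    σ⊆e-v : σ ⊆ e - v
    σ⊆e-v = toWitness σ⊆ᵇe-v
    rest : T (above v (e - v) ∧ not (any (λ γ → γ ⊆ᵇ (e - v)) (Γ st t)))
    rest = proj₂ (Equivalence.to (T-∧ {v ∈ᵇ e}) e-contributes)
    v<e-v : T (above v (e - v))
    v<e-v = proj₁ (Equivalence.to (T-∧ {above v (e - v)}) rest)
    untouched : T (not (any (λ γ → γ ⊆ᵇ (e - v)) (Γ st t)))
    untouched = proj₂ (Equivalence.to (T-∧ {above v (e - v)}) rest)

  link-before-update : ∀ st v {t σ B} →
    (∀ {w} → w ∉ σ → toℚ (dList G (Pfull (update st v) (suc t)) (σ ∪ ⁅ w ⁆)) ℚ.≤ B) →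
    (∀ {w} → w ∉ σ → toℚ (dList G (Pfull st (suc t)) (σ ∪ ⁅ w ⁆)) ℚ.≤ B)
  link-before-update st v {t} {σ} link {w} w∉σ =
    ≤-trans (toℚ-mono-≤ (Pfull-grows st v (suc t) (σ ∪ ⁅ w ⁆))) (link w∉σ)

  codegree-bounded-update : ∀ st v → BelowThreshold (toℕ v) st → CodegreeBounded st →
                            CodegreeBounded (update st v)
  codegree-bounded-update st v below bounded {t} {σ} {B} tr 0≤B link = begin
    toℚ (dList G (P (update st v) t) σ)                   ≡⟨ cong toℚ (dList-update st v σ (in-range tr)) ⟩
    toℚ (dList G (P st t) σ ℕ.+ dList G (F st v t) σ)     ≡⟨ toℚ-+ (dList G (P st t) σ) (dList G (F st v t) σ) ⟩
    toℚ (dList G (P st t) σ) + toℚ (dList G (F st v t) σ)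
      ≤⟨ split (count-map-filter-0⊎ (_- v) (contributes st v t) (σ ⊆ᵇ_) (Pfull st (suc t))) ⟩
    θ G τ t σ + B                                         ∎
    where
    open ℚ.≤-Reasoning
    split : dList G (F st v t) σ ≡ 0 ⊎ (∃ λ e → T (contributes st v t e) × T (σ ⊆ᵇ (e - v))) →
            toℚ (dList G (P st t) σ) + toℚ (dList G (F st v t) σ) ℚ.≤ θ G τ t σ + B
    split (inj₁ none) = begin
      toℚ (dList G (P st t) σ) + toℚ (dList G (F st v t) σ) ≡⟨ cong (λ k → toℚ (dList G (P st t) σ) + toℚ k) none ⟩
      toℚ (dList G (P st t) σ) + 0ℚ                         ≡⟨ ℚ.+-identityʳ (toℚ (dList G (P st t) σ)) ⟩
      toℚ (dList G (P st t) σ)                              ≤⟨ bounded tr 0≤B (link-before-update st v link) ⟩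
      θ G τ t σ + B                                         ∎
    split (inj₂ (e , e-contributes , σ⊆e-v)) =
      let σ∉Γ , σ≥v , v∉σ = F-contains-σ⇒ {st} {v} {t} {σ} {e} e-contributes σ⊆e-v
      in +-mono-≤ (below tr σ∉Γ σ≥v)
                  (≤-trans (toℚ-mono-≤ (F-count-≤ st v t σ)) (link-before-update st v link v∉σ))

  step-preserves : ∀ st v → BelowThreshold (toℕ v) st → CodegreeBounded st →
                   BelowThreshold (suc (toℕ v)) (step st v) × CodegreeBounded (step st v)
  step-preserves st v below bounded = [ unchanged , updated ]′ (step-lists st v)
    where
    unchanged : SameLists st (step st v) →
                BelowThreshold (suc (toℕ v)) (step st v) × CodegreeBounded (step st v)
    unchanged same = BelowThreshold-resp {st = st} {step st v} same
                       (λ tr σ∉Γ σ>v → below tr σ∉Γ (ℕₚ.<⇒≤ ∘ σ>v)) ,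
                     CodegreeBounded-resp {st} {step st v} same bounded
    updated : SameLists (update st v) (step st v) →
              BelowThreshold (suc (toℕ v)) (step st v) × CodegreeBounded (step st v)
    updated same = BelowThreshold-resp {st = update st v} {step st v} same (below-threshold-update st v) ,
                   CodegreeBounded-resp {update st v} {step st v} same (codegree-bounded-update st v below bounded)

  foldl-preserves : ∀ xs {k} st → Consecutive k xs → BelowThreshold k st → CodegreeBounded st →
                    CodegreeBounded (foldl step st xs)
  foldl-preserves [] st _ _ bounded = bounded
  foldl-preserves (x ∷ xs) st (refl , rest) below bounded =
    let below′ , bounded′ = step-preserves st x below bounded
    in foldl-preserves xs (step st x) rest below′ bounded′

  module _ (0≤τ : 0ℚ ℚ.≤ τ) where
    open Weights G τ using (θ-nonNeg)

    final-codegree-bounded : CodegreeBounded final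
    final-codegree-bounded = foldl-preserves (allFin n) initial (allFin-consecutive n)
      (λ {t} {σ} _ _ _ → θ-nonNeg 0≤τ t σ)
      (λ {t} {σ} _ 0≤B _ → +-nonNeg (θ-nonNeg 0≤τ t σ) 0≤B)

    codegree-bound : ∀ {t σ B} → Tracked t σ → 0ℚ ℚ.≤ B →
      (∀ {v} → v ∉ σ → toℚ (dFinal (suc t) (σ ∪ ⁅ v ⁆)) ℚ.≤ B) →
      toℚ (dFinal t σ) ℚ.≤ θ G τ t σ + B
    codegree-bound {t} {σ} {B} tr 0≤B link =
      subst (λ xs → toℚ (dList G xs σ) ℚ.≤ θ G τ t σ + B) (sym (Pfull-< final (t<r tr)))
            (final-codegree-bounded tr 0≤B link)

  dFinal-r : ∀ σ → dFinal r σ ≡ deg G σ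
  dFinal-r σ = cong (λ xs → dList G xs σ) (Pfull-r final)

module Codegrees {r n : ℕ} (G : Hypergraph r n) (τ ζ : ℚ) (mode : Mode n) (0<τ : 0ℚ ℚ.< τ) where
  open Container G τ ζ mode using (dFinal)
  open Weights G τ
  open Invariants G τ ζ mode using (Tracked; codegree-bound; dFinal-r)

  0≤τ : 0ℚ ℚ.≤ τ
  0≤τ = <⇒≤ 0<τ

  r∸t≡1+r∸[1+t] : ∀ {t} → t < r → r ∸ t ≡ suc (r ∸ suc t)
  r∸t≡1+r∸[1+t] t<r = ℕₚ.+-∸-assoc 1 t<r

  τ^[r∸[1+t]]*τ≡τ^[r∸t] : ∀ {t} → t < r → τ ^ℚ (r ∸ suc t) * τ ≡ τ ^ℚ (r ∸ t)
  τ^[r∸[1+t]]*τ≡τ^[r∸t] {t} t<r =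
    trans (ℚ.*-comm (τ ^ℚ (r ∸ suc t)) τ) (cong (τ ^ℚ_) (sym (r∸t≡1+r∸[1+t] t<r)))

  prefactor-step : ∀ {t} → t < r → prefactor (suc t) * τ ≡ prefactor t
  prefactor-step {t} t<r =
    trans (ℚ.*-assoc (toℚ 2 ^ℚ (r C 2)) (τ ^ℚ (r ∸ suc t)) τ)
          (cong (toℚ 2 ^ℚ (r C 2) *_) (τ^[r∸[1+t]]*τ≡τ^[r∸t] t<r))

  weight-step : ∀ t ℓ → weight (suc t) ℓ ≡ τ * weight t (suc ℓ)
  weight-step t ℓ = begin
    recip (toℚ 2 ^ℚ ((suc t ℕ.+ ℓ) C 2)) * recip (τ ^ℚ ℓ)
      ≡⟨ cong (λ k → recip (toℚ 2 ^ℚ (k C 2)) * recip (τ ^ℚ ℓ)) (sym (ℕₚ.+-suc t ℓ)) ⟩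
    x * recip (τ ^ℚ ℓ)
      ≡⟨ sym (trans (cong (_* (x * recip (τ ^ℚ ℓ))) (*-recipʳ 0<τ)) (*-identityˡ (x * recip (τ ^ℚ ℓ)))) ⟩
    (τ * recip τ) * (x * recip (τ ^ℚ ℓ))
      ≡⟨ solve 4 (λ a b c d → (a :* b) :* (c :* d) := a :* (c :* (b :* d))) refl τ (recip τ) x (recip (τ ^ℚ ℓ)) ⟩
    τ * (x * (recip τ * recip (τ ^ℚ ℓ)))
      ≡⟨ cong (λ y → τ * (x * y)) (sym (recip-* 0<τ (^ℚ-pos ℓ 0<τ))) ⟩
    τ * (x * recip (τ ^ℚ suc ℓ))
      ∎
    where
    open ≡-Reasoning
    x : ℚ
    x = recip (toℚ 2 ^ℚ ((t ℕ.+ suc ℓ) C 2))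

  weightedDeg-step : ∀ t {σ v} ℓ → v ∉ σ →
                     weightedDeg (suc t) (σ ∪ ⁅ v ⁆) ℓ ℚ.≤ τ * weightedDeg t σ (suc ℓ)
  weightedDeg-step t {σ} {v} ℓ v∉σ = begin
    weight (suc t) ℓ * toℚ (degMax G (∣ σ ∪ ⁅ v ⁆ ∣ ℕ.+ ℓ) (σ ∪ ⁅ v ⁆))
      ≤⟨ *-monoˡ-≤-0≤ (weight-nonNeg 0≤τ (suc t) ℓ) (toℚ-mono-≤ degMax-step) ⟩
    weight (suc t) ℓ * toℚ (degMax G (∣ σ ∣ ℕ.+ suc ℓ) σ)
      ≡⟨ cong (_* toℚ (degMax G (∣ σ ∣ ℕ.+ suc ℓ) σ)) (weight-step t ℓ) ⟩
    τ * weight t (suc ℓ) * toℚ (degMax G (∣ σ ∣ ℕ.+ suc ℓ) σ)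
      ≡⟨ ℚ.*-assoc τ (weight t (suc ℓ)) (toℚ (degMax G (∣ σ ∣ ℕ.+ suc ℓ) σ)) ⟩
    τ * weightedDeg t σ (suc ℓ)
      ∎
    where
    open ℚ.≤-Reasoning
    degMax-step : degMax G (∣ σ ∪ ⁅ v ⁆ ∣ ℕ.+ ℓ) (σ ∪ ⁅ v ⁆) ≤ degMax G (∣ σ ∣ ℕ.+ suc ℓ) σ
    degMax-step rewrite ∣p∪⁅x⁆∣≡1+∣p∣ σ v v∉σ | ℕₚ.+-suc ∣ σ ∣ ℓ =
      degMax-anti G (suc (∣ σ ∣ ℕ.+ ℓ)) (Subsetₚ.p⊆p∪q ⁅ v ⁆)

  codegreeBound : ℕ → Subset n → ℚ
  codegreeBound t σ = prefactor t * ∑[ ℓ < suc (r ∸ t) ] (toℚ (suc ℓ) * weightedDeg t σ ℓ)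

  linkBound : ℕ → Subset n → ℚ
  linkBound t σ = prefactor t * ∑[ ℓ < r ∸ t ] (toℚ (suc ℓ) * weightedDeg t σ (suc ℓ))

  linkBound-nonNeg : ∀ t σ → 0ℚ ℚ.≤ linkBound t σ
  linkBound-nonNeg t σ = *-nonNeg (prefactor-nonNeg 0≤τ t)
    (∑-nonNeg (r ∸ t) λ ℓ → *-nonNeg (toℚ-nonNeg (suc ℓ)) (weightedDeg-nonNeg 0≤τ t σ (suc ℓ)))

  θ+linkBound≡codegreeBound : ∀ t {σ} → 2 ≤ ∣ σ ∣ → θ G τ t σ + linkBound t σ ≡ codegreeBound t σ
  θ+linkBound≡codegreeBound t {σ} 2≤∣σ∣ = begin
    θ G τ t σ + linkBound t σ
      ≡⟨ cong (_+ linkBound t σ) (θ-expand t 2≤∣σ∣) ⟩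
    prefactor t * ∑ (suc (r ∸ t)) (weightedDeg t σ) + linkBound t σ
      ≡⟨ sym (ℚ.*-distribˡ-+ (prefactor t) (∑ (suc (r ∸ t)) (weightedDeg t σ)) (∑[ ℓ < r ∸ t ] (toℚ (suc ℓ) * weightedDeg t σ (suc ℓ)))) ⟩
    prefactor t * (∑ (suc (r ∸ t)) (weightedDeg t σ) + ∑[ ℓ < r ∸ t ] (toℚ (suc ℓ) * weightedDeg t σ (suc ℓ)))
      ≡⟨ cong (prefactor t *_) (∑-+-weighted-tail≡weighted-∑ (r ∸ t) (weightedDeg t σ)) ⟩
    codegreeBound t σ
      ∎
    where open ≡-Reasoning

  codegreeBound-∪⁅v⁆≤linkBound : ∀ {t σ v} → t < r → v ∉ σ →
                                 codegreeBound (suc t) (σ ∪ ⁅ v ⁆) ℚ.≤ linkBound t σ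
  codegreeBound-∪⁅v⁆≤linkBound {t} {σ} {v} t<r v∉σ = begin
    prefactor (suc t) * ∑ (suc (r ∸ suc t)) extended
      ≡⟨ cong (λ k → prefactor (suc t) * ∑ k extended) (sym (r∸t≡1+r∸[1+t] t<r)) ⟩
    prefactor (suc t) * ∑ (r ∸ t) extended
      ≤⟨ *-monoˡ-≤-0≤ (prefactor-nonNeg 0≤τ (suc t)) (∑-mono-≤ (r ∸ t) λ {ℓ} _ →
           *-monoˡ-≤-0≤ (toℚ-nonNeg (suc ℓ)) (weightedDeg-step t ℓ v∉σ)) ⟩
    prefactor (suc t) * ∑[ ℓ < r ∸ t ] (toℚ (suc ℓ) * (τ * weightedDeg t σ (suc ℓ)))
      ≡⟨ cong (prefactor (suc t) *_) (trans (∑-cong (r ∸ t) pull-τ) (sym (*-distribˡ-∑ (r ∸ t) τ tail))) ⟩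
    prefactor (suc t) * (τ * ∑ (r ∸ t) tail)
      ≡⟨ sym (ℚ.*-assoc (prefactor (suc t)) τ (∑ (r ∸ t) tail)) ⟩
    prefactor (suc t) * τ * ∑ (r ∸ t) tail
      ≡⟨ cong (_* ∑ (r ∸ t) tail) (prefactor-step t<r) ⟩
    linkBound t σ
      ∎
    where
    open ℚ.≤-Reasoning
    extended tail : ℕ → ℚ
    extended ℓ = toℚ (suc ℓ) * weightedDeg (suc t) (σ ∪ ⁅ v ⁆) ℓ
    tail ℓ = toℚ (suc ℓ) * weightedDeg t σ (suc ℓ)
    pull-τ : ∀ ℓ → toℚ (suc ℓ) * (τ * weightedDeg t σ (suc ℓ)) ≡ τ * tail ℓ
    pull-τ ℓ = *-Properties.x∙yz≈y∙xz (toℚ (suc ℓ)) τ (weightedDeg t σ (suc ℓ))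

  codegreeBound-r : ∀ σ → codegreeBound r σ ≡ toℚ (degMax G ∣ σ ∣ σ)
  codegreeBound-r σ = begin
    K * τ ^ℚ (r ∸ r) * ∑[ ℓ < suc (r ∸ r) ] (toℚ (suc ℓ) * weightedDeg r σ ℓ)
      ≡⟨ cong (λ k → K * τ ^ℚ k * ∑[ ℓ < suc k ] (toℚ (suc ℓ) * weightedDeg r σ ℓ)) (ℕₚ.n∸n≡0 r) ⟩
    K * 1ℚ * (1ℚ * (recip (toℚ 2 ^ℚ ((r ℕ.+ 0) C 2)) * 1ℚ * toℚ (degMax G (∣ σ ∣ ℕ.+ 0) σ)) + 0ℚ)
      ≡⟨ cong₂ (λ j k → K * 1ℚ * (1ℚ * (recip (toℚ 2 ^ℚ (j C 2)) * 1ℚ * toℚ (degMax G k σ)) + 0ℚ))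
               (ℕₚ.+-identityʳ r) (ℕₚ.+-identityʳ ∣ σ ∣) ⟩
    K * 1ℚ * (1ℚ * (recip K * 1ℚ * D) + 0ℚ)
      ≡⟨ solve 3 (λ k i d → k :* con 1ℚ :* (con 1ℚ :* (i :* con 1ℚ :* d) :+ con 0ℚ) := (k :* i) :* d) refl K (recip K) D ⟩
    (K * recip K) * D
      ≡⟨ cong (_* D) (*-recipʳ (^ℚ-pos (r C 2) (toℚ-pos {2} (s≤s z≤n)))) ⟩
    1ℚ * D
      ≡⟨ *-identityˡ D ⟩
    D ∎
    where
    open ≡-Reasoning
    K D : ℚ
    K = toℚ 2 ^ℚ (r C 2)
    D = toℚ (degMax G ∣ σ ∣ σ)

  dFinal≤codegreeBound-r : ∀ σ → toℚ (dFinal r σ) ℚ.≤ codegreeBound r σ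
  dFinal≤codegreeBound-r σ = begin
    toℚ (dFinal r σ)           ≡⟨ cong toℚ (dFinal-r σ) ⟩
    toℚ (deg G σ)              ≤⟨ toℚ-mono-≤ (deg≤degMax G (Subsetₚ.⊆-refl {x = σ})) ⟩
    toℚ (degMax G ∣ σ ∣ σ)     ≡⟨ sym (codegreeBound-r σ) ⟩
    codegreeBound r σ          ∎
    where open ℚ.≤-Reasoning

  dFinal≤codegreeBound : ∀ k {t σ} → r ∸ t ≡ k → 1 ≤ t → t ≤ r → 2 ≤ ∣ σ ∣ → ∣ σ ∣ ≤ t →
                         toℚ (dFinal t σ) ℚ.≤ codegreeBound t σ
  dFinal≤codegreeBound zero {t} {σ} r∸t≡0 _ t≤r _ _ =
    subst (λ t → toℚ (dFinal t σ) ℚ.≤ codegreeBound t σ) (sym (ℕₚ.≤-antisym t≤r (ℕₚ.m∸n≡0⇒m≤n r∸t≡0)))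
          (dFinal≤codegreeBound-r σ)
  dFinal≤codegreeBound (suc k) {t} {σ} r∸t≡1+k 1≤t _ 2≤∣σ∣ ∣σ∣≤t = begin
    toℚ (dFinal t σ)            ≤⟨ codegree-bound 0≤τ tracked (linkBound-nonNeg t σ) link ⟩
    θ G τ t σ + linkBound t σ   ≡⟨ θ+linkBound≡codegreeBound t 2≤∣σ∣ ⟩
    codegreeBound t σ           ∎
    where
    open ℚ.≤-Reasoning
    t<r : t < r
    t<r = ℕₚ.m∸n≢0⇒n<m (λ r∸t≡0 → ℕₚ.1+n≢0 (trans (sym r∸t≡1+k) r∸t≡0))
    tracked : Tracked t σ
    tracked = record { 1≤t = 1≤t ; t<r = t<r ; 1≤∣σ∣ = ℕₚ.≤-trans (s≤s z≤n) 2≤∣σ∣ ; ∣σ∣≤t = ∣σ∣≤t }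
    link : ∀ {v} → v ∉ σ → toℚ (dFinal (suc t) (σ ∪ ⁅ v ⁆)) ℚ.≤ linkBound t σ
    link {v} v∉σ = ≤-trans
      (dFinal≤codegreeBound k (ℕₚ.suc-injective (trans (sym (r∸t≡1+r∸[1+t] t<r)) r∸t≡1+k)) (s≤s z≤n) t<r
                (subst (2 ≤_) (sym ∣σ∪v∣) (ℕₚ.m≤n⇒m≤1+n 2≤∣σ∣)) (subst (_≤ suc t) (sym ∣σ∪v∣) (s≤s ∣σ∣≤t)))
      (codegreeBound-∪⁅v⁆≤linkBound t<r v∉σ)
      where
      ∣σ∪v∣ : ∣ σ ∪ ⁅ v ⁆ ∣ ≡ suc ∣ σ ∣
      ∣σ∪v∣ = ∣p∪⁅x⁆∣≡1+∣p∣ σ v v∉σ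

  vertexLinkBound : ℕ → Fin n → ℚ
  vertexLinkBound s u =
    prefactor (suc s) * ∑[ ℓ < r ∸ s ] (toℚ (suc ℓ) * (weight (suc s) ℓ * toℚ (degMax G (2 ℕ.+ ℓ) ⁅ u ⁆)))

  vertexLinkBound-nonNeg : ∀ s u → 0ℚ ℚ.≤ vertexLinkBound s u
  vertexLinkBound-nonNeg s u = *-nonNeg (prefactor-nonNeg 0≤τ (suc s)) (∑-nonNeg (r ∸ s) λ ℓ →
    *-nonNeg (toℚ-nonNeg (suc ℓ)) (*-nonNeg (weight-nonNeg 0≤τ (suc s) ℓ) (toℚ-nonNeg (degMax G (2 ℕ.+ ℓ) ⁅ u ⁆))))

  codegreeBound-pair≤vertexLinkBound : ∀ {s u v} → s < r → v ∉ ⁅ u ⁆ →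
                                       codegreeBound (suc s) (⁅ u ⁆ ∪ ⁅ v ⁆) ℚ.≤ vertexLinkBound s u
  codegreeBound-pair≤vertexLinkBound {s} {u} {v} s<r v∉u = begin
    prefactor (suc s) * ∑[ ℓ < suc (r ∸ suc s) ] (toℚ (suc ℓ) * weightedDeg (suc s) uv ℓ)
      ≡⟨ cong (λ k → prefactor (suc s) * ∑[ ℓ < k ] (toℚ (suc ℓ) * weightedDeg (suc s) uv ℓ))
              (sym (r∸t≡1+r∸[1+t] s<r)) ⟩
    prefactor (suc s) * ∑[ ℓ < r ∸ s ] (toℚ (suc ℓ) * weightedDeg (suc s) uv ℓ)
      ≤⟨ *-monoˡ-≤-0≤ (prefactor-nonNeg 0≤τ (suc s)) (∑-mono-≤ (r ∸ s) λ {ℓ} _ →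
           *-monoˡ-≤-0≤ (toℚ-nonNeg (suc ℓ)) (*-monoˡ-≤-0≤ (weight-nonNeg 0≤τ (suc s) ℓ) (toℚ-mono-≤ (degMax≤ ℓ)))) ⟩
    vertexLinkBound s u
      ∎
    where
    open ℚ.≤-Reasoning
    uv : Subset n
    uv = ⁅ u ⁆ ∪ ⁅ v ⁆
    ∣u,v∣≡2 : ∣ uv ∣ ≡ 2
    ∣u,v∣≡2 = trans (∣p∪⁅x⁆∣≡1+∣p∣ ⁅ u ⁆ v v∉u) (cong suc (Subsetₚ.∣⁅x⁆∣≡1 u))
    degMax≤ : ∀ ℓ → degMax G (∣ uv ∣ ℕ.+ ℓ) uv ≤ degMax G (2 ℕ.+ ℓ) ⁅ u ⁆
    degMax≤ ℓ rewrite ∣u,v∣≡2 = degMax-anti G (2 ℕ.+ ℓ) (Subsetₚ.p⊆p∪q ⁅ v ⁆)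

  dFinal-vertex-< : ∀ {s} u → 1 ≤ s → s < r →
    toℚ (dFinal s ⁅ u ⁆) ℚ.≤ τ ^ℚ (r ∸ s) * toℚ (degV G u) + vertexLinkBound s u
  dFinal-vertex-< {s} u 1≤s s<r = begin
    toℚ (dFinal s ⁅ u ⁆)
      ≤⟨ codegree-bound 0≤τ tracked (vertexLinkBound-nonNeg s u) link ⟩
    θ G τ s ⁅ u ⁆ + vertexLinkBound s u
      ≡⟨ cong (_+ vertexLinkBound s u) (θ-singleton s ∣u∣≡1) ⟩
    τ ^ℚ (r ∸ s) * toℚ (degV G u) + vertexLinkBound s u
      ∎
    where
    open ℚ.≤-Reasoning
    ∣u∣≡1 : ∣ ⁅ u ⁆ ∣ ≡ 1
    ∣u∣≡1 = Subsetₚ.∣⁅x⁆∣≡1 u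
    tracked : Tracked s ⁅ u ⁆
    tracked = record { 1≤t = 1≤s ; t<r = s<r ; 1≤∣σ∣ = ℕₚ.≤-reflexive (sym ∣u∣≡1) ; ∣σ∣≤t = subst (_≤ s) (sym ∣u∣≡1) 1≤s }
    link : ∀ {v} → v ∉ ⁅ u ⁆ → toℚ (dFinal (suc s) (⁅ u ⁆ ∪ ⁅ v ⁆)) ℚ.≤ vertexLinkBound s u
    link {v} v∉u = ≤-trans
      (dFinal≤codegreeBound (r ∸ suc s) refl (s≤s z≤n) s<r (ℕₚ.≤-reflexive (sym ∣u,v∣≡2)) (subst (_≤ suc s) (sym ∣u,v∣≡2) (s≤s 1≤s)))
      (codegreeBound-pair≤vertexLinkBound s<r v∉u)
      where
      ∣u,v∣≡2 : ∣ ⁅ u ⁆ ∪ ⁅ v ⁆ ∣ ≡ 2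
      ∣u,v∣≡2 = trans (∣p∪⁅x⁆∣≡1+∣p∣ ⁅ u ⁆ v v∉u) (cong suc ∣u∣≡1)

  dFinal-vertex-r : ∀ u → toℚ (dFinal r ⁅ u ⁆) ℚ.≤ τ ^ℚ (r ∸ r) * toℚ (degV G u) + vertexLinkBound r u
  dFinal-vertex-r u = begin
    toℚ (dFinal r ⁅ u ⁆)          ≡⟨ cong toℚ (dFinal-r ⁅ u ⁆) ⟩
    d                             ≡⟨ sym (*-identityˡ d) ⟩
    1ℚ * d                        ≡⟨ cong (λ k → τ ^ℚ k * d) (sym (ℕₚ.n∸n≡0 r)) ⟩
    τ ^ℚ (r ∸ r) * d              ≡⟨ sym (ℚ.+-identityʳ (τ ^ℚ (r ∸ r) * d)) ⟩
    τ ^ℚ (r ∸ r) * d + 0ℚ         ≤⟨ ℚ.+-monoʳ-≤ (τ ^ℚ (r ∸ r) * d) (vertexLinkBound-nonNeg r u) ⟩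
    τ ^ℚ (r ∸ r) * d + vertexLinkBound r u ∎
    where
    open ℚ.≤-Reasoning
    d : ℚ
    d = toℚ (degV G u)

  dFinal-vertex-≤ : ∀ {s} u → 1 ≤ s → s ≤ r →
    toℚ (dFinal s ⁅ u ⁆) ℚ.≤ τ ^ℚ (r ∸ s) * toℚ (degV G u) + vertexLinkBound s u
  dFinal-vertex-≤ {s} u 1≤s s≤r = [ dFinal-vertex-< u 1≤s , at-r ]′ (ℕₚ.m≤n⇒m<n∨m≡n s≤r)
    where
    at-r : s ≡ r → toℚ (dFinal s ⁅ u ⁆) ℚ.≤ τ ^ℚ (r ∸ s) * toℚ (degV G u) + vertexLinkBound s u
    at-r s≡r = subst (λ s → toℚ (dFinal s ⁅ u ⁆) ℚ.≤ τ ^ℚ (r ∸ s) * toℚ (degV G u) + vertexLinkBound s u)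
                     (sym s≡r) (dFinal-vertex-r u)

avgDeg-pos⇒nd-pos : ∀ {r n} (G : Hypergraph r n) → 0ℚ ℚ.< avgDeg G → 0ℚ ℚ.< nd G
avgDeg-pos⇒nd-pos {n = zero} G 0<d = ⊥-elim (ℚ.<-irrefl refl 0<d)
avgDeg-pos⇒nd-pos {n = suc n} G 0<d = *-pos (toℚ-pos {suc n} (s≤s z≤n)) 0<d

module DegreeSums {r n : ℕ} (G : Hypergraph r n) (τ ζ : ℚ) (mode : Mode n)
                  (0<τ : 0ℚ ℚ.< τ) (0<nd : 0ℚ ℚ.< nd G) (2≤r : 2 ≤ r) where
  open Container G τ ζ mode using (dFinal; sumDeg)
  open Weights G τ
  open Codegrees G τ ζ mode 0<τ using (0≤τ; r∸t≡1+r∸[1+t]; τ^[r∸[1+t]]*τ≡τ^[r∸t]; vertexLinkBound; dFinal-vertex-≤)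

  members : Subset n → List (Fin n)
  members U = filterᵇ (_∈ᵇ U) (allFin n)

  degSum : Subset n → ℕ
  degSum U = sumℕ (map (degV G) (members U))

  μ*nd≡degSum : ∀ U → μ G U * nd G ≡ toℚ (degSum U)
  μ*nd≡degSum U = ÷'-*-cancel (toℚ (degSum U)) 0<nd

  sumDeg-≤ : ∀ {s} U → 1 ≤ s → s ≤ r →
    toℚ (sumDeg s U) ℚ.≤ τ ^ℚ (r ∸ s) * toℚ (degSum U) + sumℚ (map (vertexLinkBound s) (members U))
  sumDeg-≤ {s} U 1≤s s≤r = begin
    toℚ (sumDeg s U)
      ≡⟨ toℚ-sumℕ (λ u → dFinal s ⁅ u ⁆) (members U) ⟩
    sumℚ (map (λ u → toℚ (dFinal s ⁅ u ⁆)) (members U))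
      ≤⟨ sumℚ-mono-≤ (members U) (λ u → dFinal-vertex-≤ u 1≤s s≤r) ⟩
    sumℚ (map (λ u → τ ^ℚ (r ∸ s) * toℚ (degV G u) + vertexLinkBound s u) (members U))
      ≡⟨ sumℚ-+ (λ u → τ ^ℚ (r ∸ s) * toℚ (degV G u)) (vertexLinkBound s) (members U) ⟩
    sumℚ (map (λ u → τ ^ℚ (r ∸ s) * toℚ (degV G u)) (members U)) + sumℚ (map (vertexLinkBound s) (members U))
      ≡⟨ cong (_+ sumℚ (map (vertexLinkBound s) (members U))) (sym pull-τ) ⟩
    τ ^ℚ (r ∸ s) * toℚ (degSum U) + sumℚ (map (vertexLinkBound s) (members U))
      ∎
    where
    open ℚ.≤-Reasoning
    pull-τ : τ ^ℚ (r ∸ s) * toℚ (degSum U) ≡ sumℚ (map (λ u → τ ^ℚ (r ∸ s) * toℚ (degV G u)) (members U))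
    pull-τ = trans (cong (τ ^ℚ (r ∸ s) *_) (toℚ-sumℕ (degV G) (members U)))
                   (*-distribˡ-sumℚ (τ ^ℚ (r ∸ s)) (toℚ ∘ degV G) (members U))

  maxCodegreeSum : ℕ → ℕ
  maxCodegreeSum ℓ = sumℕ (map (λ v → degMax G (2 ℕ.+ ℓ) ⁅ v ⁆) (allFin n))

  δj-nonNeg : ∀ j → 0ℚ ℚ.≤ δj G τ j
  δj-nonNeg j = ÷'-nonNeg (toℚ-nonNeg (sumℕ (map (λ v → degMax G j ⁅ v ⁆) (allFin n))))
                          (*-nonNeg (^ℚ-nonNeg (j ∸ 1) 0≤τ) (<⇒≤ 0<nd))

  maxCodegreeSum≡δj : ∀ ℓ → toℚ (maxCodegreeSum ℓ) ≡ δj G τ (2 ℕ.+ ℓ) * (τ ^ℚ suc ℓ * nd G)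
  maxCodegreeSum≡δj ℓ = sym (÷'-*-cancel (toℚ (maxCodegreeSum ℓ)) (*-pos (^ℚ-pos (suc ℓ) 0<τ) 0<nd))

  ∑vertexLinkBound≤ : ∀ s U → sumℚ (map (vertexLinkBound s) (members U)) ℚ.≤
    prefactor (suc s) * ∑[ ℓ < r ∸ s ] (toℚ (suc ℓ) * (weight (suc s) ℓ * toℚ (maxCodegreeSum ℓ)))
  ∑vertexLinkBound≤ s U = begin
    sumℚ (map (λ u → prefactor (suc s) * ∑ (r ∸ s) (summand u)) (members U))
      ≡⟨ sym (*-distribˡ-sumℚ (prefactor (suc s)) (λ u → ∑ (r ∸ s) (summand u)) (members U)) ⟩
    prefactor (suc s) * sumℚ (map (λ u → ∑ (r ∸ s) (summand u)) (members U))
      ≡⟨ cong (prefactor (suc s) *_) (sumℚ-∑ (r ∸ s) summand (members U)) ⟩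
    prefactor (suc s) * ∑[ ℓ < r ∸ s ] sumℚ (map (λ u → summand u ℓ) (members U))
      ≤⟨ *-monoˡ-≤-0≤ (prefactor-nonNeg 0≤τ (suc s)) (∑-mono-≤ (r ∸ s) λ {ℓ} _ → sum-over-U-≤ ℓ) ⟩
    prefactor (suc s) * ∑[ ℓ < r ∸ s ] (toℚ (suc ℓ) * (weight (suc s) ℓ * toℚ (maxCodegreeSum ℓ)))
      ∎
    where
    open ℚ.≤-Reasoning
    summand : Fin n → ℕ → ℚ
    summand u ℓ = toℚ (suc ℓ) * (weight (suc s) ℓ * toℚ (degMax G (2 ℕ.+ ℓ) ⁅ u ⁆))
    sum-over-U-≤ : ∀ ℓ → sumℚ (map (λ u → summand u ℓ) (members U)) ℚ.≤
                         toℚ (suc ℓ) * (weight (suc s) ℓ * toℚ (maxCodegreeSum ℓ))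
    sum-over-U-≤ ℓ = begin
      sumℚ (map (λ u → summand u ℓ) (members U))
        ≡⟨ sym (trans (cong (toℚ (suc ℓ) *_) (*-distribˡ-sumℚ (weight (suc s) ℓ) (λ u → toℚ (degMax G (2 ℕ.+ ℓ) ⁅ u ⁆)) (members U)))
                      (*-distribˡ-sumℚ (toℚ (suc ℓ)) (λ u → weight (suc s) ℓ * toℚ (degMax G (2 ℕ.+ ℓ) ⁅ u ⁆)) (members U))) ⟩
      toℚ (suc ℓ) * (weight (suc s) ℓ * sumℚ (map (λ u → toℚ (degMax G (2 ℕ.+ ℓ) ⁅ u ⁆)) (members U)))
        ≡⟨ cong (λ x → toℚ (suc ℓ) * (weight (suc s) ℓ * x)) (sym (toℚ-sumℕ (λ u → degMax G (2 ℕ.+ ℓ) ⁅ u ⁆) (members U))) ⟩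
      toℚ (suc ℓ) * (weight (suc s) ℓ * toℚ (sumℕ (map (λ u → degMax G (2 ℕ.+ ℓ) ⁅ u ⁆) (members U))))
        ≤⟨ *-monoˡ-≤-0≤ (toℚ-nonNeg (suc ℓ)) (*-monoˡ-≤-0≤ (weight-nonNeg 0≤τ (suc s) ℓ)
             (toℚ-mono-≤ (sumℕ-filter-≤ (λ u → degMax G (2 ℕ.+ ℓ) ⁅ u ⁆) (_∈ᵇ U) (allFin n)))) ⟩
      toℚ (suc ℓ) * (weight (suc s) ℓ * toℚ (maxCodegreeSum ℓ))
        ∎

  δ-summand : ℕ → ℕ → ℚ
  δ-summand s ℓ =
    recip (toℚ 4 ^ℚ (s ∸ 1)) * (toℚ 2 ^ℚ ((r C 2) ∸ 1) * (recip (toℚ 2 ^ℚ (suc ℓ C 2)) * δj G τ (2 ℕ.+ ℓ)))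
               * τ ^ℚ (r ∸ s) * nd G

  δ-summand-nonNeg : ∀ s ℓ → 0ℚ ℚ.≤ δ-summand s ℓ
  δ-summand-nonNeg s ℓ = *-nonNeg (*-nonNeg (*-nonNeg (recip-nonNeg (^ℚ-nonNeg (s ∸ 1) (toℚ-nonNeg 4)))
    (*-nonNeg (^ℚ-nonNeg ((r C 2) ∸ 1) (toℚ-nonNeg 2))
              (*-nonNeg (recip-nonNeg (^ℚ-nonNeg (suc ℓ C 2) (toℚ-nonNeg 2))) (δj-nonNeg (2 ℕ.+ ℓ)))))
    (^ℚ-nonNeg (r ∸ s) 0≤τ)) (<⇒≤ 0<nd)

  δ-expand : ∀ s → recip (toℚ 4 ^ℚ (s ∸ 1)) * δ G τ * τ ^ℚ (r ∸ s) * nd G ≡ ∑[ i < r ∸ 1 ] δ-summand s i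
  δ-expand s = begin
    c * (Y * sumℚ (map h (range 2 r))) * τˢ * N
      ≡⟨ cong (λ x → c * (Y * x) * τˢ * N) (∑-range h 2 r) ⟩
    c * (Y * ∑[ i < r ∸ 1 ] h (2 ℕ.+ i)) * τˢ * N
      ≡⟨ cong (λ x → c * x * τˢ * N) (*-distribˡ-∑ (r ∸ 1) Y (λ i → h (2 ℕ.+ i))) ⟩
    c * ∑[ i < r ∸ 1 ] (Y * h (2 ℕ.+ i)) * τˢ * N
      ≡⟨ cong (λ x → x * τˢ * N) (*-distribˡ-∑ (r ∸ 1) c (λ i → Y * h (2 ℕ.+ i))) ⟩
    ∑[ i < r ∸ 1 ] (c * (Y * h (2 ℕ.+ i))) * τˢ * N
      ≡⟨ cong (_* N) (*-distribʳ-∑ (r ∸ 1) τˢ (λ i → c * (Y * h (2 ℕ.+ i)))) ⟩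
    ∑[ i < r ∸ 1 ] (c * (Y * h (2 ℕ.+ i)) * τˢ) * N
      ≡⟨ *-distribʳ-∑ (r ∸ 1) N (λ i → c * (Y * h (2 ℕ.+ i)) * τˢ) ⟩
    ∑[ i < r ∸ 1 ] δ-summand s i
      ∎
    where
    open ≡-Reasoning
    c Y τˢ N : ℚ
    c = recip (toℚ 4 ^ℚ (s ∸ 1))
    Y = toℚ 2 ^ℚ ((r C 2) ∸ 1)
    τˢ = τ ^ℚ (r ∸ s)
    N = nd G
    h : ℕ → ℚ
    h j = recip (toℚ 2 ^ℚ ((j ∸ 1) C 2)) * δj G τ j

  vertexLinkTerm≤δ-summand : ∀ {s ℓ} → 1 ≤ s → ℓ < r ∸ s →
    prefactor (suc s) * (toℚ (suc ℓ) * (weight (suc s) ℓ * toℚ (maxCodegreeSum ℓ))) ℚ.≤ δ-summand s ℓ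
  vertexLinkTerm≤δ-summand {s} {ℓ} 1≤s ℓ<r∸s = begin
    (a * p) * (c * ((e * b) * toℚ (maxCodegreeSum ℓ)))
      ≡⟨ cong (λ x → (a * p) * (c * ((e * b) * x))) (maxCodegreeSum≡δj ℓ) ⟩
    (a * p) * (c * ((e * b) * (d * ((τ * q) * N))))
      ≡⟨ solve 9 (λ a p c e b d t q n → (a :* p) :* (c :* ((e :* b) :* (d :* ((t :* q) :* n))))
                                      := (a :* c :* e) :* ((p :* t) :* (q :* b) :* (d :* n))) refl a p c e b d τ q N ⟩
    (a * c * e) * ((p * τ) * (q * b) * (d * N))
      ≡⟨ cong₂ (λ x y → (a * c * e) * (x * y * (d * N))) (τ^[r∸[1+t]]*τ≡τ^[r∸t] s<r) (*-recipʳ (^ℚ-pos ℓ 0<τ)) ⟩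
    (a * c * e) * (τ ^ℚ (r ∸ s) * 1ℚ * (d * N))
      ≤⟨ *-monoʳ-≤-0≤ rest-nonNeg (weight-ratio-≤ s ℓ 1≤s 2≤r) ⟩
    (c′ * Y * f) * (τ ^ℚ (r ∸ s) * 1ℚ * (d * N))
      ≡⟨ solve 6 (λ c y f t d n → (c :* y :* f) :* (t :* con 1ℚ :* (d :* n)) := c :* (y :* (f :* d)) :* t :* n)
               refl c′ Y f (τ ^ℚ (r ∸ s)) d N ⟩
    δ-summand s ℓ
      ∎
    where
    open ℚ.≤-Reasoning
    s<r : s < r
    s<r = ℕₚ.m∸n≢0⇒n<m (λ r∸s≡0 → ℕₚ.n≮0 (subst (ℓ <_) r∸s≡0 ℓ<r∸s))
    a p c e b d q N c′ Y f : ℚ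
    a = toℚ 2 ^ℚ (r C 2)
    p = τ ^ℚ (r ∸ suc s)
    c = toℚ (suc ℓ)
    e = recip (toℚ 2 ^ℚ ((suc s ℕ.+ ℓ) C 2))
    b = recip (τ ^ℚ ℓ)
    d = δj G τ (2 ℕ.+ ℓ)
    q = τ ^ℚ ℓ
    N = nd G
    c′ = recip (toℚ 4 ^ℚ (s ∸ 1))
    Y = toℚ 2 ^ℚ ((r C 2) ∸ 1)
    f = recip (toℚ 2 ^ℚ (suc ℓ C 2))
    rest-nonNeg : 0ℚ ℚ.≤ τ ^ℚ (r ∸ s) * 1ℚ * (d * N)
    rest-nonNeg =
      *-nonNeg (*-nonNeg (^ℚ-nonNeg (r ∸ s) 0≤τ) (ℚ.nonNegative⁻¹ 1ℚ)) (*-nonNeg (δj-nonNeg (2 ℕ.+ ℓ)) (<⇒≤ 0<nd))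

  ∑vertexLinkBound≤δ : ∀ {s} U → 1 ≤ s → s ≤ r →
    sumℚ (map (vertexLinkBound s) (members U)) ℚ.≤ recip (toℚ 4 ^ℚ (s ∸ 1)) * δ G τ * τ ^ℚ (r ∸ s) * nd G
  ∑vertexLinkBound≤δ {s} U 1≤s s≤r = begin
    sumℚ (map (vertexLinkBound s) (members U))
      ≤⟨ ∑vertexLinkBound≤ s U ⟩
    prefactor (suc s) * ∑[ ℓ < r ∸ s ] (toℚ (suc ℓ) * (weight (suc s) ℓ * toℚ (maxCodegreeSum ℓ)))
      ≡⟨ *-distribˡ-∑ (r ∸ s) (prefactor (suc s)) (λ ℓ → toℚ (suc ℓ) * (weight (suc s) ℓ * toℚ (maxCodegreeSum ℓ))) ⟩
    ∑[ ℓ < r ∸ s ] (prefactor (suc s) * (toℚ (suc ℓ) * (weight (suc s) ℓ * toℚ (maxCodegreeSum ℓ))))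
      ≤⟨ ∑-mono-≤ (r ∸ s) (vertexLinkTerm≤δ-summand 1≤s) ⟩
    ∑[ ℓ < r ∸ s ] δ-summand s ℓ
      ≤⟨ ∑-≤-∑-+ (r ∸ s) (s ∸ 1) (δ-summand-nonNeg s) ⟩
    ∑[ ℓ < r ∸ s ℕ.+ (s ∸ 1) ] δ-summand s ℓ
      ≡⟨ cong (λ k → ∑[ ℓ < k ] δ-summand s ℓ) r∸s+[s∸1]≡r∸1 ⟩
    ∑[ ℓ < r ∸ 1 ] δ-summand s ℓ
      ≡⟨ sym (δ-expand s) ⟩
    recip (toℚ 4 ^ℚ (s ∸ 1)) * δ G τ * τ ^ℚ (r ∸ s) * nd G
      ∎
    where
    open ℚ.≤-Reasoning
    r∸s+[s∸1]≡r∸1 : r ∸ s ℕ.+ (s ∸ 1) ≡ r ∸ 1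
    r∸s+[s∸1]≡r∸1 = sym (trans (cong (_∸ 1) (sym (ℕₚ.m∸n+n≡m s≤r))) (ℕₚ.+-∸-assoc (r ∸ s) 1≤s))

lemma3p3 : (r n : ℕ) → 2 ≤ r → (G : Hypergraph r n) → (τ ζ : ℚ)
    → 0ℚ ℚ.< avgDeg G → 0ℚ ℚ.< τ → 0ℚ ℚ.< ζ
    → (mode : Mode n) → (U : Subset n) → (s : ℕ) → 1 ≤ s → s ≤ r
    → toℚ (Container.sumDeg G τ ζ mode s U)
      ℚ.≤ (μ G U ℚ.+ (1ℚ ÷' (toℚ 4 ^ℚ (s ∸ 1))) ℚ.* δ G τ) ℚ.* (τ ^ℚ (r ∸ s)) ℚ.* nd G
lemma3p3 r n 2≤r G τ ζ 0<d 0<τ _ mode U s 1≤s s≤r = begin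
  toℚ (Container.sumDeg G τ ζ mode s U)
    ≤⟨ sumDeg-≤ U 1≤s s≤r ⟩
  τˢ * toℚ (degSum U) + sumℚ (map (vertexLinkBound s) (members U))
    ≤⟨ ℚ.+-monoʳ-≤ (τˢ * toℚ (degSum U)) (∑vertexLinkBound≤δ U 1≤s s≤r) ⟩
  τˢ * toℚ (degSum U) + c * δ G τ * τˢ * nd G
    ≡⟨ cong (λ x → τˢ * x + c * δ G τ * τˢ * nd G) (sym (μ*nd≡degSum U)) ⟩
  τˢ * (μ G U * nd G) + c * δ G τ * τˢ * nd G
    ≡⟨ solve 4 (λ t m n c → t :* (m :* n) :+ c :* t :* n := (m :+ c) :* t :* n) refl τˢ (μ G U) (nd G) (c * δ G τ) ⟩
  (μ G U + c * δ G τ) * τˢ * nd G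
    ∎
  where
  open ℚ.≤-Reasoning
  open DegreeSums G τ ζ mode 0<τ (avgDeg-pos⇒nd-pos G 0<d) 2≤r
  open Codegrees G τ ζ mode 0<τ using (vertexLinkBound)
  τˢ c : ℚ
  τˢ = τ ^ℚ (r ∸ s)
  c = recip (toℚ 4 ^ℚ (s ∸ 1))
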